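{- Let $b>1$ be an integer. For any positive integer $L$ and $x\asymp b^{2L}$, and any $N\geq1$, $$\sum_{N/2<n\le N}\ \sum_{\substack{\ell\in\Pi_b(2L)\\ (\ell,b)=1\\ n^2\mid\ell}}1\ll\frac{x^{3/10+o(1)}}{N^{4/5}}\,\#\Pi_b(2L).$$
   Context: A natural number is a $b$-palindrome if its base-$b$ expansion reads the same forwards and backwards. $\Pi_b(K)$ is the set of all $b$-palindromes in $[b^K,b^{K+1})$. The $o(1)$ is as $x\to\infty$; implied constants may depend on $b$. -}

module Defs where

open import Data.Nat using (ℕ; zero; suc; _+_; _*_; _^_; _≤_; _<_; _≤?_; _<?_)
open import Data.Nat.DivMod using (_/_; _%_)
open import Data.Nat.Divisibility using (_∣_; _∣?_)
open import Data.Nat.GCD using (gcd)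
open import Data.Nat.Properties using (_≟_)
open import Data.List using (List; []; _∷_; reverse; filter; length; map; upTo; drop)
open import Data.List.Properties using (≡-dec)
open import Data.Nat.ListAction using (sum)
open import Relation.Binary.PropositionalEquality using (_≡_)
open import Relation.Nullary using (Dec)
open import Relation.Nullary.Decidable using (_×-dec_)

-- For b ≥ 2 and fuel ≥ n this is the full base-b expansion of n (empty for n = 0).
-- (For b = 0 the expansion is irrelevant; we return [].)
digitsAux : ℕ → ℕ → ℕ → List ℕ
digitsAux zero    _        _       = []
digitsAux (suc k) zero     _       = []
digitsAux (suc k) (suc f)  zero    = []
digitsAux (suc k) (suc f)  (suc m) = (suc m % suc k) ∷ digitsAux (suc k) f (suc m / suc k)

digits : ℕ → ℕ → List ℕ
digits b n = digitsAux b n n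

IsPalindrome : ℕ → ℕ → Set
IsPalindrome b n = reverse (digits b n) ≡ digits b n

isPalindrome? : (b n : ℕ) → Dec (IsPalindrome b n)
isPalindrome? b n = ≡-dec _≟_ (reverse (digits b n)) (digits b n)

range : ℕ → ℕ → List ℕ
range lo hi = drop lo (upTo hi)

-- Π_b(K): all b-palindromes in [b^K, b^(K+1)), as a (duplicate-free, increasing) list.
Pal : ℕ → ℕ → List ℕ
Pal b K = filter (isPalindrome? b) (range (b ^ K) (b ^ suc K))

#Pal : ℕ → ℕ → ℕ
#Pal b K = length (Pal b K)

countDiv : ℕ → ℕ → ℕ → ℕ
countDiv b L n =
  length (filter (λ ℓ → (gcd ℓ b ≟ 1) ×-dec ((n * n) ∣? ℓ)) (Pal b (2 * L)))

-- S(b,L,N) = Σ_{N/2 < n ≤ N} #{ℓ ∈ Π_b(2L) : (ℓ,b)=1, n² ∣ ℓ}.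
-- The condition N/2 < n is written N < 2n.
S : ℕ → ℕ → ℕ → ℕ
S b L N = sum (map (countDiv b L) (filter (λ n → N <? 2 * n) (range 1 (suc N))))

{-# OPTIONS --safe #-}
module Submission where

-- Write x = b^(2L) = M² and B = b^(2L+1-j). The leading j digits of a palindrome in Π_b(2L) are
-- the reversal of its trailing j digits, so palindromes congruent modulo b^j lie in a window of
-- length B. Sorting the multiples ℓ = q d of q by d mod b^j into (q b^j)-spaced classes gives
-- #{ℓ ∈ Π_b(2L) : q ∣ ℓ} q ≤ B + q b^j, and with q = n², b^j ≈ M/N this yields S ≪ M when N ≤ M.
-- Sorting instead, for a fixed cofactor d, the n ∈ (N/2, N] with d n² ∈ Π_b(2L) by n mod b^j
-- leaves ≪ B/(N d) + 1 + b^j of them; summing over the ≪ x/N² possible d with b^(2j) ≈ N yields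
-- S² N³ ≪ x². Interpolating the two bounds gives S^10 N^8 ≪ x^3 M^10, and M ≤ b #Π_b(2L) because
-- the numbers with digits 1, t, 0, t reversed, 1 (t < b^(L-1)) are distinct palindromes.

open import Data.Bool.Base using (Bool; true; false; _∧_; T)
open import Data.Bool.Properties using (T?; T-∧)
open import Data.Empty using (⊥; ⊥-elim)
open import Data.List.Base using (List; []; _∷_; _++_; [_]; _∷ʳ_; reverse; length; take; drop; map; filter; applyUpTo)
open import Data.List.Properties
  using (take++drop≡id; length-take; length-drop; reverse-++; reverse-involutive; unfold-reverse;
         length-reverse; length-++; ++-assoc)
open import Data.List.Relation.Unary.All using (All; []; _∷_)
open import Data.List.Relation.Unary.All.Properties using (take⁺; ++⁺)
open import Data.Nat.Base
open import Data.Nat.Properties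
open import Data.Nat.DivMod
open import Data.Nat.Divisibility using (_∣_; _∣?_; ∣⇒≤; ∣m+n∣m⇒∣n; n∣m*n)
open import Data.Nat.GCD using (gcd)
open import Data.Nat.Induction using (<-rec)
open import Data.Nat.ListAction using (sum)
open import Data.Nat.Solver using (module +-*-Solver)
open import Data.Nat.Tactic.RingSolver using (solve-∀)
open import Data.Product.Base using (_×_; _,_; proj₁; proj₂; ∃)
open import Data.Sum.Base using (inj₁; inj₂)
open import Function.Base using (_∘_; _∘′_)
open import Function.Bundles using (Equivalence)
open import Relation.Binary.PropositionalEquality hiding ([_])
open import Relation.Nullary using (¬_; Dec; does; yes; no; contradiction)
open import Relation.Nullary.Decidable using (_×-dec_)
open import Relation.Unary using (Pred; Decidable)

open import Defs

open +-*-Solver using (solve; _:*_; _:^_; _:=_)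

-- Finite sums and counts

𝟙 : Bool → ℕ
𝟙 true  = 1
𝟙 false = 0

∑< : ℕ → (ℕ → ℕ) → ℕ
∑< zero    f = 0
∑< (suc n) f = ∑< n f + f n

syntax ∑< n (λ x → e) = ∑[ x < n ] e

#< : ℕ → (ℕ → Bool) → ℕ
#< n g = ∑[ x < n ] 𝟙 (g x)

syntax #< n (λ x → p) = #[ x < n ] p

∑<-cong : ∀ {f g} n → (∀ x → x < n → f x ≡ g x) → ∑< n f ≡ ∑< n g
∑<-cong zero    eq = refl
∑<-cong (suc n) eq = cong₂ _+_ (∑<-cong n (λ x x<n → eq x (m<n⇒m<1+n x<n))) (eq n ≤-refl)

∑<-mono : ∀ {f g} n → (∀ x → x < n → f x ≤ g x) → ∑< n f ≤ ∑< n g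
∑<-mono zero    le = z≤n
∑<-mono (suc n) le = +-mono-≤ (∑<-mono n (λ x x<n → le x (m<n⇒m<1+n x<n))) (le n ≤-refl)

∑<-zero : ∀ {f} n → (∀ x → x < n → f x ≡ 0) → ∑< n f ≡ 0
∑<-zero zero    eq = refl
∑<-zero (suc n) eq = cong₂ _+_ (∑<-zero n (λ x x<n → eq x (m<n⇒m<1+n x<n))) (eq n ≤-refl)

∑<-≤-* : ∀ {f V} n → (∀ x → x < n → f x ≤ V) → ∑< n f ≤ n * V
∑<-≤-* zero    le = z≤n
∑<-≤-* {V = V} (suc n) le = begin
  ∑< (suc n) _             ≤⟨ +-mono-≤ (∑<-≤-* n (λ x x<n → le x (m<n⇒m<1+n x<n))) (le n ≤-refl) ⟩
  n * V + V               ≡⟨ +-comm (n * V) V ⟩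
  suc n * V               ∎
  where open ≤-Reasoning

∑<-monoʳ : ∀ (f : ℕ → ℕ) {m n} → m ≤ n → ∑< m f ≤ ∑< n f
∑<-monoʳ f {n = zero}  z≤n = z≤n
∑<-monoʳ f {n = suc n} m≤1+n with m≤n⇒m<n∨m≡n m≤1+n
... | inj₁ m<1+n = ≤-trans (∑<-monoʳ f (m<1+n⇒m≤n m<1+n)) (m≤m+n (∑< n f) (f n))
... | inj₂ refl  = ≤-refl

∑<-term : ∀ (f : ℕ → ℕ) {x n} → x < n → f x ≤ ∑< n f
∑<-term f {x} {suc n} x<1+n = ≤-trans (m≤n+m (f x) (∑< x f)) (∑<-monoʳ f x<1+n)

∑<-+ : ∀ (f g : ℕ → ℕ) n → ∑[ x < n ] (f x + g x) ≡ ∑< n f + ∑< n g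
∑<-+ f g zero    = refl
∑<-+ f g (suc n) = begin
  ∑[ x < n ] (f x + g x) + (f n + g n)  ≡⟨ cong (_+ (f n + g n)) (∑<-+ f g n) ⟩
  ∑< n f + ∑< n g + (f n + g n)         ≡⟨ interchange (∑< n f) (∑< n g) (f n) (g n) ⟩
  ∑< n f + f n + (∑< n g + g n)         ∎
  where
  open ≡-Reasoning
  interchange : ∀ a b c d → a + b + (c + d) ≡ a + c + (b + d)
  interchange = solve-∀

∑<-*ʳ : ∀ (f : ℕ → ℕ) c n → ∑[ x < n ] (f x * c) ≡ ∑< n f * c
∑<-*ʳ f c zero    = refl
∑<-*ʳ f c (suc n) = trans (cong (_+ f n * c) (∑<-*ʳ f c n)) (sym (*-distribʳ-+ c (∑< n f) (f n)))

∑<-comm : ∀ (h : ℕ → ℕ → ℕ) m n → ∑[ i < m ] ∑[ j < n ] h i j ≡ ∑[ j < n ] ∑[ i < m ] h i j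
∑<-comm h zero    n = sym (∑<-zero n (λ _ _ → refl))
∑<-comm h (suc m) n = trans (cong (_+ ∑< n (h m)) (∑<-comm h m n)) (sym (∑<-+ (λ j → ∑[ i < m ] h i j) (h m) n))

∑<-split : ∀ (f : ℕ → ℕ) m n → ∑< (m + n) f ≡ ∑< m f + ∑[ i < n ] f (m + i)
∑<-split f m zero    = trans (cong (λ k → ∑< k f) (+-identityʳ m)) (sym (+-identityʳ (∑< m f)))
∑<-split f m (suc n) = begin
  ∑< (m + suc n) f                               ≡⟨ cong (λ k → ∑< k f) (+-suc m n) ⟩
  ∑< (m + n) f + f (m + n)                       ≡⟨ cong (_+ f (m + n)) (∑<-split f m n) ⟩
  ∑< m f + ∑[ i < n ] f (m + i) + f (m + n)      ≡⟨ +-assoc (∑< m f) _ _ ⟩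
  ∑< m f + ∑[ i < suc n ] f (m + i)              ∎
  where open ≡-Reasoning

𝟙≤1 : ∀ p → 𝟙 p ≤ 1
𝟙≤1 true  = ≤-refl
𝟙≤1 false = z≤n

𝟙-false : ∀ {p} → ¬ T p → 𝟙 p ≡ 0
𝟙-false {true}  ¬p = ⊥-elim (¬p _)
𝟙-false {false} ¬p = refl

𝟙-true : ∀ {p} → T p → 𝟙 p ≡ 1
𝟙-true {true} p = refl

𝟙-mono : ∀ {p q} → (T p → T q) → 𝟙 p ≤ 𝟙 q
𝟙-mono {false}         p⇒q = z≤n
𝟙-mono {true}  {true}  p⇒q = ≤-refl
𝟙-mono {true}  {false} p⇒q = ⊥-elim (p⇒q _)

does⇒ : ∀ {A : Set} (a? : Dec A) → T (does a?) → A
does⇒ (yes a) _ = a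

⇒does : ∀ {A : Set} (a? : Dec A) → A → T (does a?)
⇒does (yes _) _ = _
⇒does (no ¬a) a = ¬a a

#<-≤ : ∀ (g : ℕ → Bool) n → #< n g ≤ n
#<-≤ g n = ≤-trans (∑<-≤-* n (λ x _ → 𝟙≤1 (g x))) (≤-reflexive (*-identityʳ n))

#<-mono : ∀ {g h} n → (∀ x → x < n → T (g x) → T (h x)) → #< n g ≤ #< n h
#<-mono n g⇒h = ∑<-mono n (λ x x<n → 𝟙-mono (g⇒h x x<n))

#<-none : ∀ {g} n → (∀ x → x < n → ¬ T (g x)) → #< n g ≡ 0
#<-none n none = ∑<-zero n (λ x x<n → 𝟙-false (none x x<n))

#<-gap : ∀ {g m n} → m ≤ n → (∀ x → m ≤ x → x < n → ¬ T (g x)) → #< n g ≡ #< m g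
#<-gap {g} {m} {n} m≤n gap = begin
  #< n g                                  ≡⟨ cong (λ k → #< k g) (sym (m+[n∸m]≡n m≤n)) ⟩
  #< (m + (n ∸ m)) g                      ≡⟨ ∑<-split (λ x → 𝟙 (g x)) m (n ∸ m) ⟩
  #< m g + #[ i < n ∸ m ] g (m + i)       ≡⟨ cong (#< m g +_) (#<-none (n ∸ m) outside) ⟩
  #< m g + 0                              ≡⟨ +-identityʳ (#< m g) ⟩
  #< m g                                  ∎
  where
  open ≡-Reasoning
  outside : ∀ i → i < n ∸ m → ¬ T (g (m + i))
  outside i i<n∸m = gap (m + i) (m≤m+n m i) (subst (m + i <_) (m+[n∸m]≡n m≤n) (+-monoʳ-< m i<n∸m))

#<-shift : ∀ {g} m n → (∀ x → x < m → ¬ T (g x)) → #< (m + n) g ≡ #[ i < n ] g (m + i)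
#<-shift {g} m n none = trans (∑<-split (λ x → 𝟙 (g x)) m n) (cong (_+ #[ i < n ] g (m + i)) (#<-none m none))

#<-partition : ∀ (g : ℕ → Bool) (κ : ℕ → ℕ) M U → (∀ x → κ x < M) →
  #< U g ≤ ∑[ c < M ] #[ x < U ] (g x ∧ (κ x ≡ᵇ c))
#<-partition g κ M U κ<M = begin
  #< U g                                       ≤⟨ ∑<-mono U (λ x _ → split x) ⟩
  ∑[ x < U ] ∑[ c < M ] 𝟙 (g x ∧ (κ x ≡ᵇ c))   ≡⟨ ∑<-comm (λ x c → 𝟙 (g x ∧ (κ x ≡ᵇ c))) U M ⟩
  ∑[ c < M ] #[ x < U ] (g x ∧ (κ x ≡ᵇ c))     ∎
  where
  open ≤-Reasoning
  split : ∀ x → 𝟙 (g x) ≤ ∑[ c < M ] 𝟙 (g x ∧ (κ x ≡ᵇ c))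
  split x with g x
  ... | false = z≤n
  ... | true  = ≤-trans (≤-reflexive (sym (𝟙-true (≡⇒≡ᵇ (κ x) (κ x) refl))))
                        (∑<-term (λ c → 𝟙 (κ x ≡ᵇ c)) (κ<M x))

#<-multiples : ∀ (g : ℕ → Bool) q .{{_ : NonZero q}} → (∀ x → T (g x) → q ∣ x) →
  ∀ M → #< (M * q) g ≡ #[ d < M ] g (d * q)
#<-multiples g q multiple zero    = refl
#<-multiples g q multiple (suc M) = begin
  #< (q + M * q) g                            ≡⟨ cong (λ k → #< k g) (+-comm q (M * q)) ⟩
  #< (M * q + q) g                            ≡⟨ ∑<-split (λ x → 𝟙 (g x)) (M * q) q ⟩
  #< (M * q) g + #[ i < q ] g (M * q + i)     ≡⟨ cong₂ _+_ (#<-multiples g q multiple M) block ⟩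
  #[ d < M ] g (d * q) + 𝟙 (g (M * q))        ∎
  where
  open ≡-Reasoning
  nonMultiple : ∀ i → 1 ≤ i → i < q → ¬ T (g (M * q + i))
  nonMultiple i 1≤i i<q gi =
    <⇒≱ i<q (∣⇒≤ {{>-nonZero 1≤i}} (∣m+n∣m⇒∣n (multiple (M * q + i) gi) (n∣m*n M)))
  block : #[ i < q ] g (M * q + i) ≡ 𝟙 (g (M * q))
  block = trans (#<-gap (>-nonZero⁻¹ q) nonMultiple) (cong (λ x → 𝟙 (g x)) (+-identityʳ (M * q)))

#<-without-zero : ∀ (g : ℕ → Bool) n → ¬ T (g 0) → #< n g ≤ n ∸ 1
#<-without-zero g zero    _     = z≤n
#<-without-zero g (suc n) ¬g0 = begin
  #< (1 + n) g                    ≡⟨ ∑<-split (λ x → 𝟙 (g x)) 1 n ⟩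
  0 + 𝟙 (g 0) + #[ i < n ] g (1 + i)  ≡⟨ cong (_+ #[ i < n ] g (1 + i)) (𝟙-false ¬g0) ⟩
  #[ i < n ] g (1 + i)            ≤⟨ #<-≤ (λ i → g (1 + i)) n ⟩
  n                               ∎
  where open ≤-Reasoning

#<-positive-multiples : ∀ q Y D → #[ d < D ] ((1 ≤ᵇ d) ∧ (d * q <ᵇ Y)) * q ≤ Y
#<-positive-multiples q Y zero    = z≤n
#<-positive-multiples q Y (suc D) = lastTerm (T? (g D))
  where
  open ≤-Reasoning
  g : ℕ → Bool
  g d = (1 ≤ᵇ d) ∧ (d * q <ᵇ Y)
  lastTerm : Dec (T (g D)) → (#< D g + 𝟙 (g D)) * q ≤ Y
  lastTerm (no ¬gD) = begin
    (#< D g + 𝟙 (g D)) * q  ≡⟨ cong (λ k → (#< D g + k) * q) (𝟙-false ¬gD) ⟩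
    (#< D g + 0) * q        ≡⟨ cong (_* q) (+-identityʳ (#< D g)) ⟩
    #< D g * q              ≤⟨ #<-positive-multiples q Y D ⟩
    Y                       ∎
  lastTerm (yes gD) = begin
    (#< D g + 𝟙 (g D)) * q  ≤⟨ *-monoˡ-≤ q (+-mono-≤ (#<-without-zero g D (λ ())) (𝟙≤1 (g D))) ⟩
    (D ∸ 1 + 1) * q         ≡⟨ cong (_* q) (m∸n+n≡m (≤ᵇ⇒≤ 1 D 1≤D)) ⟩
    D * q                   <⟨ <ᵇ⇒< (D * q) Y D*q<Y ⟩
    Y                       ∎
    where
    1≤D : T (1 ≤ᵇ D)
    1≤D = proj₁ (Equivalence.to T-∧ gD)
    D*q<Y : T (D * q <ᵇ Y)
    D*q<Y = proj₂ (Equivalence.to T-∧ gD)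

#<-increasing : ∀ {g} (F : ℕ → ℕ) M U → (∀ {s t} → s < t → t < M → F s < F t) →
  (∀ t → t < M → F t < U × T (g (F t))) → M ≤ #< U g
#<-increasing         F zero    U increasing image = z≤n
#<-increasing {g} F (suc M) U increasing image = begin
  suc M                     ≤⟨ s≤s (#<-increasing F M (F M) (λ s<t t<M → increasing s<t (m<n⇒m<1+n t<M)) earlier) ⟩
  suc (#< (F M) g)          ≡⟨ +-comm 1 (#< (F M) g) ⟩
  #< (F M) g + 1            ≡⟨ cong (#< (F M) g +_) (sym (𝟙-true (proj₂ (image M ≤-refl)))) ⟩
  #< (suc (F M)) g          ≤⟨ ∑<-monoʳ (λ x → 𝟙 (g x)) (proj₁ (image M ≤-refl)) ⟩
  #< U g                    ∎
  where
  open ≤-Reasoning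
  earlier : ∀ t → t < M → F t < F M × T (g (F t))
  earlier t t<M = increasing t<M ≤-refl , proj₂ (image t (m<n⇒m<1+n t<M))

-- Spaced sets

Spaced : ℕ → (ℕ → Bool) → Set
Spaced q g = ∀ {x y} → x < y → T (g x) → T (g y) → x + q ≤ y

#<-spaced : ∀ {q g} → 1 ≤ q → Spaced q g → ∀ w → #< w g * q ≤ w + q
#<-spaced {q} {g} 1≤q spaced = <-rec _ bound
  where
  open ≤-Reasoning
  bound : ∀ w → (∀ {v} → v < w → #< v g * q ≤ v + q) → #< w g * q ≤ w + q
  bound zero    _   = z≤n
  bound (suc w) rec = lastTerm (T? (g w))
    where
    lastTerm : Dec (T (g w)) → (#< w g + 𝟙 (g w)) * q ≤ suc w + q
    lastTerm (no ¬gw) = begin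
      (#< w g + 𝟙 (g w)) * q  ≡⟨ cong (λ k → (#< w g + k) * q) (𝟙-false ¬gw) ⟩
      (#< w g + 0) * q        ≡⟨ cong (_* q) (+-identityʳ (#< w g)) ⟩
      #< w g * q              ≤⟨ rec ≤-refl ⟩
      w + q                   ≤⟨ +-monoˡ-≤ q (n≤1+n w) ⟩
      suc w + q               ∎
    lastTerm (yes gw) = begin
      (#< w g + 𝟙 (g w)) * q  ≡⟨ cong (λ k → (k + 𝟙 (g w)) * q) (#<-gap v≤w nothingClose) ⟩
      (#< v g + 𝟙 (g w)) * q  ≡⟨ cong (λ k → (#< v g + k) * q) (𝟙-true gw) ⟩
      (#< v g + 1) * q        ≡⟨ *-distribʳ-+ q (#< v g) 1 ⟩
      #< v g * q + 1 * q      ≡⟨ cong (#< v g * q +_) (*-identityˡ q) ⟩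
      #< v g * q + q          ≤⟨ +-monoˡ-≤ q earlier ⟩
      suc w + q               ∎
      where
      v : ℕ
      v = suc w ∸ q
      v≤w : v ≤ w
      v≤w = ∸-monoʳ-≤ (suc w) 1≤q
      nothingClose : ∀ x → v ≤ x → x < w → ¬ T (g x)
      nothingClose x v≤x x<w gx = <⇒≱ (s≤s (spaced x<w gx gw)) (begin
        suc w      ≤⟨ m≤n+m∸n (suc w) q ⟩
        q + v      ≤⟨ +-monoʳ-≤ q v≤x ⟩
        q + x      ≡⟨ +-comm q x ⟩
        x + q      ∎)
      earlier : #< v g * q ≤ suc w
      earlier with q ≤? suc w
      ... | yes q≤1+w = ≤-trans (rec (s≤s v≤w)) (≤-reflexive (m∸n+n≡m q≤1+w))
      ... | no  q≰1+w = subst (λ k → #< k g * q ≤ suc w) (sym (m≤n⇒m∸n≡0 (≰⇒≥ q≰1+w))) z≤n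

Spaced-shift : ∀ {q g} a → Spaced q g → Spaced q (λ i → g (a + i))
Spaced-shift {q} a spaced {x} {y} x<y gx gy =
  +-cancelˡ-≤ a (x + q) y (subst (_≤ a + y) (+-assoc a x q) (spaced (+-monoʳ-< a x<y) gx gy))

#<-spaced-diameter : ∀ {q g} U W → 1 ≤ q → Spaced q g →
  (∀ {x y} → x < y → y < U → T (g x) → T (g y) → y ≤ x + W) → #< U g * q ≤ 1 + W + q
#<-spaced-diameter             zero    W 1≤q spaced diameter = z≤n
#<-spaced-diameter {q} {g} (suc V) W 1≤q spaced diameter = lastTerm (T? (g V))
  where
  open ≤-Reasoning
  lastTerm : Dec (T (g V)) → #< (suc V) g * q ≤ 1 + W + q
  lastTerm (no ¬gV) = begin
    (#< V g + 𝟙 (g V)) * q  ≡⟨ cong (λ k → (#< V g + k) * q) (𝟙-false ¬gV) ⟩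
    (#< V g + 0) * q        ≡⟨ cong (_* q) (+-identityʳ (#< V g)) ⟩
    #< V g * q              ≤⟨ #<-spaced-diameter V W 1≤q spaced (λ x<y y<V → diameter x<y (m<n⇒m<1+n y<V)) ⟩
    1 + W + q               ∎
  lastTerm (yes gV) = begin
    #< (suc V) g * q                ≡⟨ cong (λ k → #< k g * q) (sym (m+[n∸m]≡n a≤1+V)) ⟩
    #< (a + (suc V ∸ a)) g * q      ≡⟨ cong (_* q) (#<-shift a (suc V ∸ a) belowA) ⟩
    #[ i < suc V ∸ a ] g (a + i) * q ≤⟨ #<-spaced 1≤q (Spaced-shift a spaced) (suc V ∸ a) ⟩
    (suc V ∸ a) + q                 ≤⟨ +-monoˡ-≤ q (m≤n+o⇒m∸n≤o (suc V) a 1+V≤a+1+W) ⟩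
    1 + W + q                       ∎
    where
    a : ℕ
    a = V ∸ W
    a≤1+V : a ≤ suc V
    a≤1+V = ≤-trans (m∸n≤m V W) (n≤1+n V)
    1+V≤a+1+W : suc V ≤ a + (1 + W)
    1+V≤a+1+W = subst (suc V ≤_) (+-comm (1 + W) a) (s≤s (m≤n+m∸n V W))
    belowA : ∀ x → x < a → ¬ T (g x)
    belowA x x<a gx = <⇒≱ x<a (m≤n+o⇒m∸n≤o V W (subst (V ≤_) (+-comm x W) (diameter x<V ≤-refl gx gV)))
      where
      x<V : x < V
      x<V = <-≤-trans x<a (m∸n≤m V W)

#<-spaced-classes : ∀ {q} U W M (g : ℕ → Bool) (κ : ℕ → ℕ) → 1 ≤ q → (∀ x → κ x < M) →
  (∀ {x y} → x < y → T (g x) → T (g y) → κ x ≡ κ y → x + q ≤ y) →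
  (∀ {x y} → x < y → y < U → T (g x) → T (g y) → κ x ≡ κ y → y ≤ x + W) →
  #< U g * q ≤ M * (1 + W + q)
#<-spaced-classes {q} U W M g κ 1≤q κ<M spaced diameter = begin
  #< U g * q                     ≤⟨ *-monoˡ-≤ q (#<-partition g κ M U κ<M) ⟩
  ∑[ c < M ] #< U (class c) * q  ≡⟨ ∑<-*ʳ (λ c → #< U (class c)) q M ⟨
  ∑[ c < M ] (#< U (class c) * q) ≤⟨ ∑<-≤-* M (λ c _ → #<-spaced-diameter U W 1≤q (classSpaced c) (classDiameter c)) ⟩
  M * (1 + W + q)                ∎
  where
  open ≤-Reasoning
  class : ℕ → ℕ → Bool
  class c x = g x ∧ (κ x ≡ᵇ c)
  member : ∀ {c x} → T (class c x) → T (g x)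
  member = proj₁ ∘ Equivalence.to T-∧
  sameClass : ∀ {c x y} → T (class c x) → T (class c y) → κ x ≡ κ y
  sameClass {c} {x} {y} cx cy =
    trans (≡ᵇ⇒≡ (κ x) c (proj₂ (Equivalence.to T-∧ cx))) (sym (≡ᵇ⇒≡ (κ y) c (proj₂ (Equivalence.to T-∧ cy))))
  classSpaced : ∀ c → Spaced q (class c)
  classSpaced c x<y cx cy = spaced x<y (member cx) (member cy) (sameClass cx cy)
  classDiameter : ∀ c {x y} → x < y → y < U → T (class c x) → T (class c y) → y ≤ x + W
  classDiameter c x<y y<U cx cy = diameter x<y y<U (member cx) (member cy) (sameClass cx cy)

sum-map-filter : ∀ {p} {P : Pred ℕ p} (P? : Decidable P) (f : ℕ → ℕ) xs →
  sum (map f (filter P? xs)) ≡ sum (map (λ x → 𝟙 (does (P? x)) * f x) xs)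
sum-map-filter P? f []       = refl
sum-map-filter P? f (x ∷ xs) with does (P? x)
... | true  = cong₂ _+_ (sym (+-identityʳ (f x))) (sum-map-filter P? f xs)
... | false = sum-map-filter P? f xs

sum-map-applyUpTo : ∀ (f g : ℕ → ℕ) n → sum (map f (applyUpTo g n)) ≡ ∑[ i < n ] f (g i)
sum-map-applyUpTo f g zero    = refl
sum-map-applyUpTo f g (suc n) = trans (cong (f (g 0) +_) (sum-map-applyUpTo f (g ∘ suc) n)) (sym (∑<-split (f ∘ g) 1 n))

drop-applyUpTo : ∀ {A : Set} (g : ℕ → A) m n → drop m (applyUpTo g n) ≡ applyUpTo (λ i → g (m + i)) (n ∸ m)
drop-applyUpTo g zero    n       = refl
drop-applyUpTo g (suc m) zero    = refl
drop-applyUpTo g (suc m) (suc n) = drop-applyUpTo (g ∘ suc) m n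

sum-map-range : ∀ (f : ℕ → ℕ) lo hi → lo ≤ hi → sum (map f (range lo hi)) ≡ ∑[ x < hi ] (𝟙 (lo ≤ᵇ x) * f x)
sum-map-range f lo hi lo≤hi = begin
  sum (map f (drop lo (applyUpTo (λ x → x) hi)))        ≡⟨ cong (sum ∘ map f) (drop-applyUpTo (λ x → x) lo hi) ⟩
  sum (map f (applyUpTo (lo +_) (hi ∸ lo)))             ≡⟨ sum-map-applyUpTo f (lo +_) (hi ∸ lo) ⟩
  ∑[ i < hi ∸ lo ] f (lo + i)                           ≡⟨ ∑<-cong (hi ∸ lo) (λ i _ → sym (inside i)) ⟩
  ∑[ i < hi ∸ lo ] (𝟙 (lo ≤ᵇ lo + i) * f (lo + i))      ≡⟨ cong (_+ ∑[ i < hi ∸ lo ] (𝟙 (lo ≤ᵇ lo + i) * f (lo + i))) (∑<-zero lo below) ⟨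
  ∑[ x < lo ] (𝟙 (lo ≤ᵇ x) * f x) + ∑[ i < hi ∸ lo ] (𝟙 (lo ≤ᵇ lo + i) * f (lo + i)) ≡⟨ ∑<-split (λ x → 𝟙 (lo ≤ᵇ x) * f x) lo (hi ∸ lo) ⟨
  ∑[ x < lo + (hi ∸ lo) ] (𝟙 (lo ≤ᵇ x) * f x)           ≡⟨ cong (λ n → ∑[ x < n ] (𝟙 (lo ≤ᵇ x) * f x)) (m+[n∸m]≡n lo≤hi) ⟩
  ∑[ x < hi ] (𝟙 (lo ≤ᵇ x) * f x)                       ∎
  where
  open ≡-Reasoning
  inside : ∀ i → 𝟙 (lo ≤ᵇ lo + i) * f (lo + i) ≡ f (lo + i)
  inside i = trans (cong (_* f (lo + i)) (𝟙-true (≤⇒≤ᵇ (m≤m+n lo i)))) (+-identityʳ (f (lo + i)))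
  below : ∀ x → x < lo → 𝟙 (lo ≤ᵇ x) * f x ≡ 0
  below x x<lo = cong (_* f x) (𝟙-false (<⇒≱ x<lo ∘ ≤ᵇ⇒≤ lo x))

length≡sum-map-1 : ∀ {A : Set} (xs : List A) → length xs ≡ sum (map (λ _ → 1) xs)
length≡sum-map-1 []       = refl
length≡sum-map-1 (x ∷ xs) = cong suc (length≡sum-map-1 xs)

All-reverse : ∀ {A : Set} {P : A → Set} {xs} → All P xs → All P (reverse xs)
All-reverse             []         = []
All-reverse {P = P} {x ∷ xs} (px ∷ pxs) = subst (All P) (sym (unfold-reverse x xs)) (++⁺ (All-reverse pxs) (px ∷ []))

take-length-++ : ∀ {A : Set} (xs ys : List A) → take (length xs) (xs ++ ys) ≡ xs
take-length-++ []       ys = refl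
take-length-++ (x ∷ xs) ys = cong (x ∷_) (take-length-++ xs ys)

take-reverse : ∀ {A : Set} j (xs : List A) → j ≤ length xs →
  take j (reverse xs) ≡ reverse (drop (length xs ∸ j) xs)
take-reverse j xs j≤n = begin
  take j (reverse xs)                               ≡⟨ cong (take j ∘′ reverse) (take++drop≡id k xs) ⟨
  take j (reverse (take k xs ++ drop k xs))         ≡⟨ cong (take j) (reverse-++ (take k xs) (drop k xs)) ⟩
  take j (reverse (drop k xs) ++ reverse (take k xs)) ≡⟨ cong (λ i → take i (reverse (drop k xs) ++ reverse (take k xs))) length-suffix ⟨
  take (length (reverse (drop k xs))) (reverse (drop k xs) ++ reverse (take k xs)) ≡⟨ take-length-++ (reverse (drop k xs)) (reverse (take k xs)) ⟩
  reverse (drop k xs)                               ∎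
  where
  open ≡-Reasoning
  k : ℕ
  k = length xs ∸ j
  length-suffix : length (reverse (drop k xs)) ≡ j
  length-suffix = trans (length-reverse (drop k xs)) (trans (length-drop k xs) (m∸[m∸n]≡n j≤n))

reverse-mirror : ∀ {A : Set} (x : A) ws → reverse (reverse ws ++ (x ∷ ws)) ≡ reverse ws ++ (x ∷ ws)
reverse-mirror x ws = begin
  reverse (reverse ws ++ (x ∷ ws))           ≡⟨ reverse-++ (reverse ws) (x ∷ ws) ⟩
  reverse (x ∷ ws) ++ reverse (reverse ws)   ≡⟨ cong₂ _++_ (unfold-reverse x ws) (reverse-involutive ws) ⟩
  (reverse ws ∷ʳ x) ++ ws                    ≡⟨ ++-assoc (reverse ws) [ x ] ws ⟩
  reverse ws ++ (x ∷ ws)                     ∎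
  where open ≡-Reasoning

[r+k*q]%q≡r : ∀ r k q .{{_ : NonZero q}} → r < q → (r + k * q) % q ≡ r
[r+k*q]%q≡r r k q r<q = trans ([m+kn]%n≡m%n r k q) (m<n⇒m%n≡m r<q)

[r+k*q]/q≡k : ∀ r k q .{{_ : NonZero q}} → r < q → (r + k * q) / q ≡ k
[r+k*q]/q≡k r k q r<q = trans (+-distrib-/-∣ʳ r (n∣m*n k)) (cong₂ _+_ (m<n⇒m/n≡0 r<q) (m*n/n≡m k q))

%-≡⇒+≤ : ∀ {x y m} .{{_ : NonZero m}} → x < y → x % m ≡ y % m → x + m ≤ y
%-≡⇒+≤ {x} {y} {m} x<y x≡y = begin
  x + m                          ≡⟨ cong (_+ m) (m≡m%n+[m/n]*n x m) ⟩
  x % m + x / m * m + m          ≡⟨ rearrange (x % m) (x / m) m ⟩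
  x % m + suc (x / m) * m        ≤⟨ +-mono-≤ (≤-reflexive x≡y) (*-monoˡ-≤ m quotient<) ⟩
  y % m + y / m * m              ≡⟨ m≡m%n+[m/n]*n y m ⟨
  y                              ∎
  where
  open ≤-Reasoning
  rearrange : ∀ r k m → r + k * m + m ≡ r + (m + k * m)
  rearrange = solve-∀
  quotient< : x / m < y / m
  quotient< = ≰⇒> λ y/m≤x/m → <⇒≱ x<y (begin
    y                  ≡⟨ m≡m%n+[m/n]*n y m ⟩
    y % m + y / m * m  ≤⟨ +-mono-≤ (≤-reflexive (sym x≡y)) (*-monoˡ-≤ m y/m≤x/m) ⟩
    x % m + x / m * m  ≡⟨ m≡m%n+[m/n]*n x m ⟨
    x                  ∎)

[x/q]%m≡[y/q]%m⇒x+q*m≤y : ∀ {x y q m} .{{_ : NonZero q}} .{{_ : NonZero m}} → q ∣ x → q ∣ y → x < y →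
  (x / q) % m ≡ (y / q) % m → x + q * m ≤ y
[x/q]%m≡[y/q]%m⇒x+q*m≤y {x} {y} {q} {m} q∣x q∣y x<y x≡y = begin
  x + q * m              ≡⟨ cong₂ _+_ (m/n*n≡m q∣x) (*-comm m q) ⟨
  x / q * q + m * q      ≡⟨ *-distribʳ-+ q (x / q) m ⟨
  (x / q + m) * q        ≤⟨ *-monoˡ-≤ q (%-≡⇒+≤ quotient< x≡y) ⟩
  y / q * q              ≡⟨ m/n*n≡m q∣y ⟩
  y                      ∎
  where
  open ≤-Reasoning
  quotient< : x / q < y / q
  quotient< = *-cancelʳ-< q (x / q) (y / q) (subst₂ _<_ (sym (m/n*n≡m q∣x)) (sym (m/n*n≡m q∣y)) x<y)

%-cong-*ʳ : ∀ {a a′} k m .{{_ : NonZero m}} → a % m ≡ a′ % m → (a * k) % m ≡ (a′ * k) % m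
%-cong-*ʳ {a} {a′} k m a≡a′ = begin
  (a * k) % m              ≡⟨ %-distribˡ-* a k m ⟩
  (a % m * (k % m)) % m    ≡⟨ cong (λ r → (r * (k % m)) % m) a≡a′ ⟩
  (a′ % m * (k % m)) % m   ≡⟨ %-distribˡ-* a′ k m ⟨
  (a′ * k) % m             ∎
  where open ≡-Reasoning

%-cong-*ˡ : ∀ {a a′} k m .{{_ : NonZero m}} → a % m ≡ a′ % m → (k * a) % m ≡ (k * a′) % m
%-cong-*ˡ {a} {a′} k m a≡a′ =
  trans (cong (_% m) (*-comm k a)) (trans (%-cong-*ʳ k m a≡a′) (cong (_% m) (*-comm a′ k)))

m<2n⇒m*m≤4*[n*n] : ∀ {m n} → m < 2 * n → m * m ≤ 4 * (n * n)
m<2n⇒m*m≤4*[n*n] {m} {n} m<2n = ≤-trans (*-mono-≤ (<⇒≤ m<2n) (<⇒≤ m<2n)) (≤-reflexive (square-double n))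
  where
  square-double : ∀ n → 2 * n * (2 * n) ≡ 4 * (n * n)
  square-double = solve-∀

d*y²<d*x²+B⇒[y∸x]*[N*d]<B : ∀ {N d x y B} → N < 2 * x → x ≤ y → d * (y * y) < d * (x * x) + B → (y ∸ x) * (N * d) < B
d*y²<d*x²+B⇒[y∸x]*[N*d]<B {N} {d} {x} {y} {B} N<2x x≤y window = begin-strict
  t * (N * d)              ≤⟨ *-monoʳ-≤ t (subst (_≤ d * (2 * x + t)) (*-comm d N) (*-monoʳ-≤ d (≤-trans (<⇒≤ N<2x) (m≤m+n (2 * x) t)))) ⟩
  t * (d * (2 * x + t))    <⟨ +-cancelˡ-< (d * (x * x)) _ _ (subst (_< d * (x * x) + B) (trans (cong (λ z → d * (z * z)) (sym (m+[n∸m]≡n x≤y))) (expand d x t)) window) ⟩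
  B                        ∎
  where
  open ≤-Reasoning
  t : ℕ
  t = y ∸ x
  expand : ∀ d x t → d * ((x + t) * (x + t)) ≡ d * (x * x) + t * (d * (2 * x + t))
  expand = solve-∀

^-distribʳ-* : ∀ m n k → (m * n) ^ k ≡ m ^ k * n ^ k
^-distribʳ-* m n zero    = refl
^-distribʳ-* m n (suc k) = trans (cong (m * n *_) (^-distribʳ-* m n k)) (interchange m n (m ^ k) (n ^ k))
  where
  interchange : ∀ m n x y → m * n * (x * y) ≡ m * x * (n * y)
  interchange = solve-∀

pow-bracket : ∀ B → 1 < B → ∀ y → 1 ≤ y → ∃ λ j → B ^ j ≤ y × y < B ^ suc j
pow-bracket B 1<B = <-rec _ bracket
  where
  instance
    B≢0 : NonZero B
    B≢0 = >-nonZero (<-trans z<s 1<B)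
  bracket : ∀ y → (∀ {z} → z < y → 1 ≤ z → ∃ λ j → B ^ j ≤ z × z < B ^ suc j) → 1 ≤ y → ∃ λ j → B ^ j ≤ y × y < B ^ suc j
  bracket y rec 1≤y with y <? B
  ... | yes y<B = 0 , 1≤y , subst (y <_) (sym (*-identityʳ B)) y<B
  ... | no  y≮B with rec (m/n<m y B {{>-nonZero 1≤y}} 1<B) (m≥n⇒m/n>0 (≮⇒≥ y≮B))
  ...   | j , B^j≤y/B , y/B<B^[1+j] = suc j , lower , upper
    where
    open ≤-Reasoning
    lower : B ^ suc j ≤ y
    lower = begin
      B * B ^ j    ≡⟨ *-comm B (B ^ j) ⟩
      B ^ j * B    ≤⟨ *-monoˡ-≤ B B^j≤y/B ⟩
      y / B * B    ≤⟨ m/n*n≤m y B ⟩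
      y            ∎
    upper : y < B ^ suc (suc j)
    upper = begin-strict
      y                    ≡⟨ m≡m%n+[m/n]*n y B ⟩
      y % B + y / B * B    <⟨ +-monoˡ-< (y / B * B) (m%n<n y B) ⟩
      suc (y / B) * B      ≤⟨ *-monoˡ-≤ B y/B<B^[1+j] ⟩
      B ^ suc j * B        ≡⟨ *-comm (B ^ suc j) B ⟩
      B ^ suc (suc j)      ∎

pow-bracket-/ : ∀ B → 1 < B → ∀ {M N} .{{_ : NonZero N}} → N ≤ M → ∃ λ j → B ^ j * N ≤ M × M < B ^ suc j * N
pow-bracket-/ B 1<B {M} {N} N≤M with pow-bracket B 1<B (M / N) (m≥n⇒m/n>0 N≤M)
... | j , B^j≤M/N , M/N<B^[1+j] = j , ≤-trans (*-monoˡ-≤ N B^j≤M/N) (m/n*n≤m M N) , (begin-strict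
  M                  ≡⟨ m≡m%n+[m/n]*n M N ⟩
  M % N + M / N * N  <⟨ +-monoˡ-< (M / N * N) (m%n<n M N) ⟩
  suc (M / N) * N    ≤⟨ *-monoˡ-≤ N M/N<B^[1+j] ⟩
  B ^ suc j * N      ∎)
  where open ≤-Reasoning

m^6<n^8⇒m^4≤n^7 : ∀ m n .{{_ : NonZero m}} → m ^ 6 < n ^ 8 → m ^ 4 ≤ n ^ 7
m^6<n^8⇒m^4≤n^7 m n m^6<n^8 = ≮⇒≥ λ n^7<m^4 → <-irrefl refl (begin-strict
  (n ^ 7) ^ 8    <⟨ ^-monoˡ-< 8 n^7<m^4 ⟩
  (m ^ 4) ^ 8    ≡⟨ ^-*-assoc m 4 8 ⟩
  m ^ 32         ≤⟨ ^-monoʳ-≤ m (m≤m+n 32 10) ⟩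
  m ^ 42         ≡⟨ ^-*-assoc m 6 7 ⟨
  (m ^ 6) ^ 7    <⟨ ^-monoˡ-< 7 m^6<n^8 ⟩
  (n ^ 8) ^ 7    ≡⟨ trans (^-*-assoc n 8 7) (sym (^-*-assoc n 7 8)) ⟩
  (n ^ 7) ^ 8    ∎)
  where open ≤-Reasoning

interpolate : ∀ s N M c₁ c₂ .{{_ : NonZero M}} → (N ≤ M → s ≤ c₁ * M) → s * s * (N * N * N) ≤ c₂ * (M * M * M * M) →
  s ^ 10 * N ^ 8 ≤ (c₁ ^ 10 + c₂ ^ 5) * M ^ 16
interpolate s N M c₁ c₂ small-N large-N with N ^ 8 ≤? M ^ 6
... | yes N^8≤M^6 = begin
  s ^ 10 * N ^ 8               ≤⟨ *-mono-≤ (^-monoˡ-≤ 10 (small-N N≤M)) N^8≤M^6 ⟩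
  (c₁ * M) ^ 10 * M ^ 6        ≡⟨ solve 2 (λ a x → (a :* x) :^ 10 :* x :^ 6 := a :^ 10 :* x :^ 16) refl c₁ M ⟩
  c₁ ^ 10 * M ^ 16             ≤⟨ *-monoˡ-≤ (M ^ 16) (m≤m+n (c₁ ^ 10) (c₂ ^ 5)) ⟩
  (c₁ ^ 10 + c₂ ^ 5) * M ^ 16  ∎
  where
  open ≤-Reasoning
  N≤M : N ≤ M
  N≤M = ≮⇒≥ λ M<N → <⇒≱ (^-monoˡ-< 8 M<N) (≤-trans N^8≤M^6 (^-monoʳ-≤ M (m≤m+n 6 2)))
... | no  N^8≰M^6 = *-cancelʳ-≤ _ _ (M ^ 4) {{m^n≢0 M 4}} (begin
  s ^ 10 * N ^ 8 * M ^ 4                 ≤⟨ *-monoʳ-≤ (s ^ 10 * N ^ 8) (m^6<n^8⇒m^4≤n^7 M N (≰⇒> N^8≰M^6)) ⟩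
  s ^ 10 * N ^ 8 * N ^ 7                 ≡⟨ solve 2 (λ s n → s :^ 10 :* n :^ 8 :* n :^ 7 := (s :* s :* (n :* n :* n)) :^ 5) refl s N ⟩
  (s * s * (N * N * N)) ^ 5              ≤⟨ ^-monoˡ-≤ 5 large-N ⟩
  (c₂ * (M * M * M * M)) ^ 5             ≡⟨ solve 2 (λ a x → (a :* (x :* x :* x :* x)) :^ 5 := a :^ 5 :* x :^ 16 :* x :^ 4) refl c₂ M ⟩
  c₂ ^ 5 * M ^ 16 * M ^ 4                ≤⟨ *-monoˡ-≤ (M ^ 4) (*-monoˡ-≤ (M ^ 16) (m≤n+m (c₂ ^ 5) (c₁ ^ 10))) ⟩
  (c₁ ^ 10 + c₂ ^ 5) * M ^ 16 * M ^ 4    ∎)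
  where open ≤-Reasoning

power-bound : ∀ {s N M C} m x P b .{{_ : NonZero x}} → s ^ 10 * N ^ 8 ≤ C * M ^ 16 → M * M ≡ x → M ≤ b * P →
  s ^ (10 * m) * N ^ (8 * m) ≤ C ^ m * b ^ (10 * m) * x ^ (3 * m + 10) * P ^ (10 * m)
power-bound {s} {N} {M} {C} m x P b bound M*M≡x M≤b*P = begin
  s ^ (10 * m) * N ^ (8 * m)                 ≡⟨ cong₂ _*_ (^-*-assoc s 10 m) (^-*-assoc N 8 m) ⟨
  (s ^ 10) ^ m * (N ^ 8) ^ m                 ≡⟨ ^-distribʳ-* (s ^ 10) (N ^ 8) m ⟨
  (s ^ 10 * N ^ 8) ^ m                       ≤⟨ ^-monoˡ-≤ m bound ⟩
  (C * M ^ 16) ^ m                           ≡⟨ ^-distribʳ-* C (M ^ 16) m ⟩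
  C ^ m * (M ^ 16) ^ m                       ≡⟨ cong (C ^ m *_) (trans (cong (_^ m) (^-distribˡ-+-* M 6 10)) (^-distribʳ-* (M ^ 6) (M ^ 10) m)) ⟩
  C ^ m * ((M ^ 6) ^ m * (M ^ 10) ^ m)       ≤⟨ *-monoʳ-≤ (C ^ m) (*-mono-≤ M^6m≤x^[3m+10] M^10m≤[b*P]^10m) ⟩
  C ^ m * (x ^ (3 * m + 10) * (b ^ (10 * m) * P ^ (10 * m))) ≡⟨ rearrange (C ^ m) (x ^ (3 * m + 10)) (b ^ (10 * m)) (P ^ (10 * m)) ⟩
  C ^ m * b ^ (10 * m) * x ^ (3 * m + 10) * P ^ (10 * m)     ∎
  where
  open ≤-Reasoning
  rearrange : ∀ a u v w → a * (u * (v * w)) ≡ a * v * u * w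
  rearrange = solve-∀
  M^6m≤x^[3m+10] : (M ^ 6) ^ m ≤ x ^ (3 * m + 10)
  M^6m≤x^[3m+10] = begin
    (M ^ 6) ^ m          ≡⟨ cong (_^ m) (solve 1 (λ y → y :^ 6 := (y :* y) :^ 3) refl M) ⟩
    ((M * M) ^ 3) ^ m    ≡⟨ cong (λ y → (y ^ 3) ^ m) M*M≡x ⟩
    (x ^ 3) ^ m          ≡⟨ ^-*-assoc x 3 m ⟩
    x ^ (3 * m)          ≤⟨ ^-monoʳ-≤ x (m≤m+n (3 * m) 10) ⟩
    x ^ (3 * m + 10)     ∎
  M^10m≤[b*P]^10m : (M ^ 10) ^ m ≤ b ^ (10 * m) * P ^ (10 * m)
  M^10m≤[b*P]^10m = begin
    (M ^ 10) ^ m                   ≤⟨ ^-monoˡ-≤ m (^-monoˡ-≤ 10 M≤b*P) ⟩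
    ((b * P) ^ 10) ^ m             ≡⟨ ^-*-assoc (b * P) 10 m ⟩
    (b * P) ^ (10 * m)             ≡⟨ ^-distribʳ-* b P (10 * m) ⟩
    b ^ (10 * m) * P ^ (10 * m)    ∎

module Base (c : ℕ) where

  -- With b = 2 + c rather than a variable b > 1, digitsAux b computes.
  b : ℕ
  b = 2 + c

  b^[2L]≡b^L*b^L : ∀ L → b ^ (2 * L) ≡ b ^ L * b ^ L
  b^[2L]≡b^L*b^L L = trans (cong (λ n → b ^ (L + n)) (+-identityʳ L)) (^-distribˡ-+-* b L L)

  fromDigits : List ℕ → ℕ
  fromDigits []       = 0
  fromDigits (d ∷ ds) = d + fromDigits ds * b

  fromDigits-++ : ∀ xs ys → fromDigits (xs ++ ys) ≡ fromDigits xs + fromDigits ys * b ^ length xs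
  fromDigits-++ []       ys = sym (*-identityʳ (fromDigits ys))
  fromDigits-++ (x ∷ xs) ys = begin
    x + fromDigits (xs ++ ys) * b                               ≡⟨ cong (λ v → x + v * b) (fromDigits-++ xs ys) ⟩
    x + (fromDigits xs + fromDigits ys * b ^ length xs) * b     ≡⟨ distribute x (fromDigits xs) (fromDigits ys) (b ^ length xs) b ⟩
    x + fromDigits xs * b + fromDigits ys * (b * b ^ length xs) ∎
    where
    open ≡-Reasoning
    distribute : ∀ x e y p b → x + (e + y * p) * b ≡ x + e * b + y * (b * p)
    distribute = solve-∀

  fromDigits-< : ∀ {xs} → All (_< b) xs → fromDigits xs < b ^ length xs
  fromDigits-< []                    = s≤s z≤n
  fromDigits-< {x ∷ xs} (x<b ∷ xs<b) = begin-strict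
    x + fromDigits xs * b       <⟨ +-monoˡ-< (fromDigits xs * b) x<b ⟩
    suc (fromDigits xs) * b     ≤⟨ *-monoˡ-≤ b (fromDigits-< xs<b) ⟩
    b ^ length xs * b           ≡⟨ *-comm (b ^ length xs) b ⟩
    b * b ^ length xs           ∎
    where open ≤-Reasoning

  digitsAux-zero : ∀ f → digitsAux b f 0 ≡ []
  digitsAux-zero zero    = refl
  digitsAux-zero (suc f) = refl

  digitsAux-suc : ∀ f {m} → 1 ≤ m → digitsAux b (suc f) m ≡ m % b ∷ digitsAux b f (m / b)
  digitsAux-suc f {suc m} _ = refl

  [1+m]/b≤f : ∀ {m f} → m ≤ f → suc m / b ≤ f
  [1+m]/b≤f m≤f = m<1+n⇒m≤n (≤-trans (m/n<m _ b (s≤s (s≤s z≤n))) (s≤s m≤f))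

  fromDigits-digitsAux : ∀ f m → m ≤ f → fromDigits (digitsAux b f m) ≡ m
  fromDigits-digitsAux zero    zero    _         = refl
  fromDigits-digitsAux (suc f) zero    _         = refl
  fromDigits-digitsAux (suc f) (suc m) (s≤s m≤f) = begin
    suc m % b + fromDigits (digitsAux b f (suc m / b)) * b  ≡⟨ cong (λ v → suc m % b + v * b) (fromDigits-digitsAux f (suc m / b) ([1+m]/b≤f m≤f)) ⟩
    suc m % b + suc m / b * b                               ≡⟨ m≡m%n+[m/n]*n (suc m) b ⟨
    suc m                                                   ∎
    where open ≡-Reasoning

  fromDigits-digits : ∀ m → fromDigits (digits b m) ≡ m
  fromDigits-digits m = fromDigits-digitsAux m m ≤-refl

  digitsAux-< : ∀ f m → All (_< b) (digitsAux b f m)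
  digitsAux-< zero    m       = []
  digitsAux-< (suc f) zero    = []
  digitsAux-< (suc f) (suc m) = m%n<n (suc m) b ∷ digitsAux-< f (suc m / b)

  length-digitsAux : ∀ K f m → m ≤ f → b ^ K ≤ m → m < b ^ suc K → length (digitsAux b f m) ≡ suc K
  length-digitsAux K       f       zero    _         b^K≤0 _       = contradiction b^K≤0 (<⇒≱ (m^n>0 b K))
  length-digitsAux zero    (suc f) (suc m) _         _     m<b     = begin
    suc (length (digitsAux b f (suc m / b)))  ≡⟨ cong (λ q → suc (length (digitsAux b f q))) (m<n⇒m/n≡0 (subst (suc m <_) (*-identityʳ b) m<b)) ⟩
    suc (length (digitsAux b f 0))            ≡⟨ cong (suc ∘ length) (digitsAux-zero f) ⟩
    1                                         ∎
    where open ≡-Reasoning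
  length-digitsAux (suc K) (suc f) (suc m) (s≤s m≤f) b^K≤m m<b^K = cong suc (length-digitsAux K f (suc m / b) ([1+m]/b≤f m≤f)
    (subst (_≤ suc m / b) (m*n/n≡m (b ^ K) b) (/-monoˡ-≤ b (subst (_≤ suc m) (*-comm b (b ^ K)) b^K≤m)))
    (m<n*o⇒m/o<n (subst (suc m <_) (*-comm b (b ^ suc K)) m<b^K)))

  1≤fromDigits-∷ʳ : ∀ xs {d} → 1 ≤ d → 1 ≤ fromDigits (xs ∷ʳ d)
  1≤fromDigits-∷ʳ []       1≤d = ≤-trans 1≤d (m≤m+n _ _)
  1≤fromDigits-∷ʳ (x ∷ xs) 1≤d = ≤-trans (≤-trans (1≤fromDigits-∷ʳ xs 1≤d) (m≤m*n _ b)) (m≤n+m _ x)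

  digitsAux-fromDigits : ∀ f xs {d} → All (_< b) xs → 1 ≤ d → d < b → fromDigits (xs ∷ʳ d) ≤ f →
    digitsAux b f (fromDigits (xs ∷ʳ d)) ≡ xs ∷ʳ d
  digitsAux-fromDigits zero    xs       _            1≤d _   v≤0 = contradiction v≤0 (<⇒≱ (1≤fromDigits-∷ʳ xs 1≤d))
  digitsAux-fromDigits (suc f) []       {d} []           1≤d d<b _   = begin
    digitsAux b (suc f) (d + 0 * b)                   ≡⟨ digitsAux-suc f (≤-trans 1≤d (m≤m+n d (0 * b))) ⟩
    (d + 0 * b) % b ∷ digitsAux b f ((d + 0 * b) / b) ≡⟨ cong₂ (λ r q → r ∷ digitsAux b f q) ([r+k*q]%q≡r d 0 b d<b) ([r+k*q]/q≡k d 0 b d<b) ⟩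
    d ∷ digitsAux b f 0                               ≡⟨ cong (d ∷_) (digitsAux-zero f) ⟩
    d ∷ []                                            ∎
    where open ≡-Reasoning
  digitsAux-fromDigits (suc f) (x ∷ xs) {d} (x<b ∷ xs<b) 1≤d d<b v≤1+f = begin
    digitsAux b (suc f) (x + E * b)                   ≡⟨ digitsAux-suc f (≤-trans 1≤E (≤-trans (m≤m*n E b) (m≤n+m (E * b) x))) ⟩
    (x + E * b) % b ∷ digitsAux b f ((x + E * b) / b) ≡⟨ cong₂ (λ r q → r ∷ digitsAux b f q) ([r+k*q]%q≡r x E b x<b) ([r+k*q]/q≡k x E b x<b) ⟩
    x ∷ digitsAux b f E                               ≡⟨ cong (x ∷_) (digitsAux-fromDigits f xs xs<b 1≤d d<b E≤f) ⟩
    x ∷ (xs ∷ʳ d)                                     ∎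
    where
    open ≡-Reasoning
    E : ℕ
    E = fromDigits (xs ∷ʳ d)
    1≤E : 1 ≤ E
    1≤E = 1≤fromDigits-∷ʳ xs 1≤d
    E≤f : E ≤ f
    E≤f = m<1+n⇒m≤n (≤-trans (<-≤-trans (m<m*n E b {{>-nonZero 1≤E}} (s≤s (s≤s z≤n))) (m≤n+m (E * b) x)) v≤1+f)

  module _ (j : ℕ) where

    private instance
      b^j≢0 : NonZero (b ^ j)
      b^j≢0 = m^n≢0 b j

    module _ {es : List ℕ} (es<b : All (_< b) es) (j≤n : j ≤ length es) where

      private
        length-prefix : length (take j es) ≡ j
        length-prefix = trans (length-take j es) (m≤n⇒m⊓n≡m j≤n)

        prefix<b^j : fromDigits (take j es) < b ^ j
        prefix<b^j = subst (λ i → fromDigits (take j es) < b ^ i) length-prefix (fromDigits-< (take⁺ j es<b))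

        split : fromDigits es ≡ fromDigits (take j es) + fromDigits (drop j es) * b ^ j
        split = begin
          fromDigits es                                                            ≡⟨ cong fromDigits (take++drop≡id j es) ⟨
          fromDigits (take j es ++ drop j es)                                      ≡⟨ fromDigits-++ (take j es) (drop j es) ⟩
          fromDigits (take j es) + fromDigits (drop j es) * b ^ length (take j es) ≡⟨ cong (λ i → fromDigits (take j es) + fromDigits (drop j es) * b ^ i) length-prefix ⟩
          fromDigits (take j es) + fromDigits (drop j es) * b ^ j                  ∎
          where open ≡-Reasoning

      fromDigits-%-b^ : fromDigits es % b ^ j ≡ fromDigits (take j es)
      fromDigits-%-b^ = trans (cong (_% b ^ j) split) ([r+k*q]%q≡r (fromDigits (take j es)) (fromDigits (drop j es)) (b ^ j) prefix<b^j)

      fromDigits-/-b^ : fromDigits es / b ^ j ≡ fromDigits (drop j es)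
      fromDigits-/-b^ = trans (cong (_/ b ^ j) split) ([r+k*q]/q≡k (fromDigits (take j es)) (fromDigits (drop j es)) (b ^ j) prefix<b^j)

  reverseDigits : ℕ → ℕ → ℕ
  reverseDigits zero    r = 0
  reverseDigits (suc j) r = r % b * b ^ j + reverseDigits j (r / b)

  reverseDigits-fromDigits : ∀ {xs} → All (_< b) xs → reverseDigits (length xs) (fromDigits xs) ≡ fromDigits (reverse xs)
  reverseDigits-fromDigits []                    = refl
  reverseDigits-fromDigits {x ∷ xs} (x<b ∷ xs<b) = begin
    (x + F * b) % b * b ^ n + reverseDigits n ((x + F * b) / b)          ≡⟨ cong₂ (λ r k → r * b ^ n + reverseDigits n k) ([r+k*q]%q≡r x F b x<b) ([r+k*q]/q≡k x F b x<b) ⟩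
    x * b ^ n + reverseDigits n F                                        ≡⟨ cong (x * b ^ n +_) (reverseDigits-fromDigits xs<b) ⟩
    x * b ^ n + fromDigits (reverse xs)                                  ≡⟨ swap x (b ^ n) (fromDigits (reverse xs)) b ⟩
    fromDigits (reverse xs) + fromDigits [ x ] * b ^ n                   ≡⟨ cong (λ i → fromDigits (reverse xs) + fromDigits [ x ] * b ^ i) (length-reverse xs) ⟨
    fromDigits (reverse xs) + fromDigits [ x ] * b ^ length (reverse xs) ≡⟨ fromDigits-++ (reverse xs) [ x ] ⟨
    fromDigits (reverse xs ∷ʳ x)                                         ≡⟨ cong fromDigits (unfold-reverse x xs) ⟨
    fromDigits (reverse (x ∷ xs))                                        ∎
    where
    open ≡-Reasoning
    F n : ℕ
    F = fromDigits xs
    n = length xs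
    swap : ∀ x p r b → x * p + r ≡ r + (x + 0 * b) * p
    swap = solve-∀

  -- Palindromes

  infix 4 _∈Π_ _∈Π?_

  _∈Π_ : ℕ → ℕ → Set
  ℓ ∈Π K = b ^ K ≤ ℓ × ℓ < b ^ suc K × IsPalindrome b ℓ

  _∈Π?_ : ∀ ℓ K → Dec (ℓ ∈Π K)
  ℓ ∈Π? K = (b ^ K ≤? ℓ) ×-dec (ℓ <? b ^ suc K) ×-dec isPalindrome? b ℓ

  isΠ : ℕ → ℕ → Bool
  isΠ K ℓ = does (ℓ ∈Π? K)

  isΠ⇒∈Π : ∀ K {ℓ} → T (isΠ K ℓ) → ℓ ∈Π K
  isΠ⇒∈Π K {ℓ} = does⇒ (ℓ ∈Π? K)

  length-digits : ∀ {K ℓ} → ℓ ∈Π K → length (digits b ℓ) ≡ suc K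
  length-digits {K} {ℓ} (b^K≤ℓ , ℓ<b^[1+K] , _) = length-digitsAux K ℓ ℓ ≤-refl b^K≤ℓ ℓ<b^[1+K]

  #Π-multiples : ℕ → ℕ → ℕ
  #Π-multiples K q = #[ ℓ < b ^ suc K ] (isΠ K ℓ ∧ does (q ∣? ℓ))

  #Π-d*n² : ℕ → ℕ → ℕ → ℕ
  #Π-d*n² K N d = #[ n < suc N ] (does (N <? 2 * n) ∧ isΠ K (d * (n * n)))

  module _ {K j : ℕ} (j≤1+K : j ≤ suc K) where

    private instance
      b^j≢0 : NonZero (b ^ j)
      b^j≢0 = m^n≢0 b j
      b^[1+K∸j]≢0 : NonZero (b ^ (suc K ∸ j))
      b^[1+K∸j]≢0 = m^n≢0 b (suc K ∸ j)

    palindrome-leading-digits : ∀ {ℓ} → ℓ ∈Π K → ℓ / b ^ (suc K ∸ j) ≡ reverseDigits j (ℓ % b ^ j)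
    palindrome-leading-digits {ℓ} ℓ∈Π@(_ , _ , palindrome) = begin
      ℓ / b ^ (suc K ∸ j)                                         ≡⟨ cong (_/ b ^ (suc K ∸ j)) (fromDigits-digits ℓ) ⟨
      fromDigits es / b ^ (suc K ∸ j)                             ≡⟨ fromDigits-/-b^ (suc K ∸ j) es<b (subst (suc K ∸ j ≤_) (sym n≡1+K) (m∸n≤m (suc K) j)) ⟩
      fromDigits (drop (suc K ∸ j) es)                            ≡⟨ cong (λ i → fromDigits (drop (i ∸ j) es)) n≡1+K ⟨
      fromDigits (drop (length es ∸ j) es)                        ≡⟨ cong fromDigits (reverse-involutive (drop (length es ∸ j) es)) ⟨
      fromDigits (reverse (reverse (drop (length es ∸ j) es)))    ≡⟨ cong (fromDigits ∘′ reverse) (take-reverse j es j≤n) ⟨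
      fromDigits (reverse (take j (reverse es)))                  ≡⟨ cong (λ xs → fromDigits (reverse (take j xs))) palindrome ⟩
      fromDigits (reverse (take j es))                            ≡⟨ reverseDigits-fromDigits (take⁺ j es<b) ⟨
      reverseDigits (length (take j es)) (fromDigits (take j es)) ≡⟨ cong₂ reverseDigits (trans (length-take j es) (m≤n⇒m⊓n≡m j≤n)) (sym (fromDigits-%-b^ j es<b j≤n)) ⟩
      reverseDigits j (fromDigits es % b ^ j)                     ≡⟨ cong (λ m → reverseDigits j (m % b ^ j)) (fromDigits-digits ℓ) ⟩
      reverseDigits j (ℓ % b ^ j)                                 ∎
      where
      open ≡-Reasoning
      es : List ℕ
      es = digits b ℓ
      es<b : All (_< b) es
      es<b = digitsAux-< ℓ ℓ
      n≡1+K : length es ≡ suc K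
      n≡1+K = length-digits ℓ∈Π
      j≤n : j ≤ length es
      j≤n = subst (j ≤_) (sym n≡1+K) j≤1+K

    palindrome-window : ∀ {ℓ ℓ′} → ℓ ∈Π K → ℓ′ ∈Π K → ℓ % b ^ j ≡ ℓ′ % b ^ j → ℓ ≤ ℓ′ → ℓ′ < ℓ + b ^ (suc K ∸ j)
    palindrome-window {ℓ} {ℓ′} ℓ∈Π ℓ′∈Π ℓ≡ℓ′ ℓ≤ℓ′ = begin-strict
      ℓ′                   ≡⟨ m≡m%n+[m/n]*n ℓ′ B ⟩
      ℓ′ % B + ℓ′ / B * B  <⟨ +-monoˡ-< (ℓ′ / B * B) (m%n<n ℓ′ B) ⟩
      B + ℓ′ / B * B       ≡⟨ cong (λ k → B + k * B) sameLeadingDigits ⟨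
      B + ℓ / B * B        ≤⟨ +-monoʳ-≤ B (m/n*n≤m ℓ B) ⟩
      B + ℓ                ≡⟨ +-comm B ℓ ⟩
      ℓ + B                ∎
      where
      open ≤-Reasoning
      B : ℕ
      B = b ^ (suc K ∸ j)
      sameLeadingDigits : ℓ / B ≡ ℓ′ / B
      sameLeadingDigits = trans (palindrome-leading-digits ℓ∈Π)
        (trans (cong (reverseDigits j) ℓ≡ℓ′) (sym (palindrome-leading-digits ℓ′∈Π)))

    -- The classes of ℓ = q d by d mod b^j are (q b^j)-spaced and, by palindrome-window, have diameter < b^(1+K-j).
    #Π-multiples*q≤ : ∀ q .{{_ : NonZero q}} → #Π-multiples K q * q ≤ b ^ (suc K ∸ j) + q * b ^ j
    #Π-multiples*q≤ q = *-cancelʳ-≤ _ _ (b ^ j) (begin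
      #< hi g * q * b ^ j                  ≡⟨ *-assoc (#< hi g) q (b ^ j) ⟩
      #< hi g * (q * b ^ j)                ≤⟨ #<-spaced-classes hi (pred B) (b ^ j) g κ 1≤q*b^j (λ ℓ → m%n<n (ℓ / q) (b ^ j)) spaced diameter ⟩
      b ^ j * (suc (pred B) + q * b ^ j)   ≡⟨ cong (λ w → b ^ j * (w + q * b ^ j)) (suc-pred B) ⟩
      b ^ j * (B + q * b ^ j)              ≡⟨ *-comm (b ^ j) _ ⟩
      (B + q * b ^ j) * b ^ j              ∎)
      where
      open ≤-Reasoning
      hi B : ℕ
      hi = b ^ suc K
      B = b ^ (suc K ∸ j)
      g : ℕ → Bool
      g ℓ = isΠ K ℓ ∧ does (q ∣? ℓ)
      κ : ℕ → ℕ
      κ ℓ = (ℓ / q) % b ^ j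
      1≤q*b^j : 1 ≤ q * b ^ j
      1≤q*b^j = *-mono-≤ (>-nonZero⁻¹ q) (m^n>0 b j)
      ∈Π : ∀ {ℓ} → T (g ℓ) → ℓ ∈Π K
      ∈Π = isΠ⇒∈Π K ∘ proj₁ ∘ Equivalence.to T-∧
      q∣ : ∀ {ℓ} → T (g ℓ) → q ∣ ℓ
      q∣ {ℓ} gℓ = does⇒ (q ∣? ℓ) (proj₂ (Equivalence.to T-∧ gℓ))
      spaced : ∀ {x y} → x < y → T (g x) → T (g y) → κ x ≡ κ y → x + q * b ^ j ≤ y
      spaced x<y gx gy = [x/q]%m≡[y/q]%m⇒x+q*m≤y (q∣ gx) (q∣ gy) x<y
      diameter : ∀ {x y} → x < y → y < hi → T (g x) → T (g y) → κ x ≡ κ y → y ≤ x + pred B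
      diameter {x} {y} x<y _ gx gy κx≡κy = m<1+n⇒m≤n (begin-strict
        y                   <⟨ palindrome-window (∈Π gx) (∈Π gy) x≡y (<⇒≤ x<y) ⟩
        x + B               ≡⟨ cong (x +_) (suc-pred B) ⟨
        x + suc (pred B)    ≡⟨ +-suc x (pred B) ⟩
        suc (x + pred B)    ∎)
        where
        x≡y : x % b ^ j ≡ y % b ^ j
        x≡y = trans (cong (_% b ^ j) (sym (m/n*n≡m (q∣ gx))))
          (trans (%-cong-*ʳ q (b ^ j) κx≡κy) (cong (_% b ^ j) (m/n*n≡m (q∣ gy))))

    -- Within a class of n mod b^j, d n² mod b^j is fixed, so palindrome-window bounds d (y² - x²) by b^(1+K-j).
    #Π-d*n²≤ : ∀ N d .{{_ : NonZero (N * d)}} → #Π-d*n² K N d ≤ 1 + b ^ (suc K ∸ j) / (N * d) + b ^ j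
    #Π-d*n²≤ N d = *-cancelʳ-≤ _ _ (b ^ j) (begin
      #< (suc N) g * b ^ j          ≤⟨ #<-spaced-classes (suc N) W (b ^ j) g κ (m^n>0 b j) (λ n → m%n<n n (b ^ j)) (λ x<y _ _ → %-≡⇒+≤ x<y) diameter ⟩
      b ^ j * (1 + W + b ^ j)       ≡⟨ *-comm (b ^ j) _ ⟩
      (1 + W + b ^ j) * b ^ j       ∎)
      where
      open ≤-Reasoning
      B W : ℕ
      B = b ^ (suc K ∸ j)
      W = B / (N * d)
      g : ℕ → Bool
      g n = does (N <? 2 * n) ∧ isΠ K (d * (n * n))
      κ : ℕ → ℕ
      κ n = n % b ^ j
      parts : ∀ {n} → T (g n) → N < 2 * n × d * (n * n) ∈Π K
      parts {n} gn with Equivalence.to (T-∧ {does (N <? 2 * n)}) gn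
      ... | N<2n , inΠ = <ᵇ⇒< N (2 * n) N<2n , isΠ⇒∈Π K inΠ
      diameter : ∀ {x y} → x < y → y < suc N → T (g x) → T (g y) → κ x ≡ κ y → y ≤ x + W
      diameter {x} {y} x<y _ gx gy κx≡κy = begin
        y                ≡⟨ m+[n∸m]≡n (<⇒≤ x<y) ⟨
        x + (y ∸ x)      ≤⟨ +-monoʳ-≤ x (subst (_≤ W) (m*n/n≡m (y ∸ x) (N * d)) (/-monoˡ-≤ (N * d) (<⇒≤ gap))) ⟩
        x + W            ∎
        where
        squares≡ : (d * (x * x)) % b ^ j ≡ (d * (y * y)) % b ^ j
        squares≡ = %-cong-*ˡ d (b ^ j) (trans (%-cong-*ʳ x (b ^ j) κx≡κy) (%-cong-*ˡ y (b ^ j) κx≡κy))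
        window : d * (y * y) < d * (x * x) + B
        window = palindrome-window (proj₂ (parts {x} gx)) (proj₂ (parts {y} gy)) squares≡ (*-monoʳ-≤ d (*-mono-≤ (<⇒≤ x<y) (<⇒≤ x<y)))
        gap : (y ∸ x) * (N * d) < B
        gap = d*y²<d*x²+B⇒[y∸x]*[N*d]<B (proj₁ (parts {x} gx)) (<⇒≤ x<y) window

  paddedDigits : ℕ → ℕ → List ℕ
  paddedDigits zero    t = []
  paddedDigits (suc k) t = t % b ∷ paddedDigits k (t / b)

  length-paddedDigits : ∀ k t → length (paddedDigits k t) ≡ k
  length-paddedDigits zero    t = refl
  length-paddedDigits (suc k) t = cong suc (length-paddedDigits k (t / b))

  paddedDigits-< : ∀ k t → All (_< b) (paddedDigits k t)
  paddedDigits-< zero    t = []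
  paddedDigits-< (suc k) t = m%n<n t b ∷ paddedDigits-< k (t / b)

  fromDigits-paddedDigits : ∀ k t → t < b ^ k → fromDigits (paddedDigits k t) ≡ t
  fromDigits-paddedDigits zero    zero    _     = refl
  fromDigits-paddedDigits zero    (suc t) (s≤s ())
  fromDigits-paddedDigits (suc k) t       t<b^k = begin
    t % b + fromDigits (paddedDigits k (t / b)) * b  ≡⟨ cong (λ v → t % b + v * b) (fromDigits-paddedDigits k (t / b) (m<n*o⇒m/o<n (subst (t <_) (*-comm b (b ^ k)) t<b^k))) ⟩
    t % b + t / b * b                               ≡⟨ m≡m%n+[m/n]*n t b ⟨
    t                                               ∎
    where open ≡-Reasoning

  module _ (L′ : ℕ) where

    private
      L K : ℕ
      L = suc L′
      K = 2 * L

    upperHalf : ℕ → List ℕ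
    upperHalf t = paddedDigits L′ t ∷ʳ 1

    palindromeDigits : ℕ → List ℕ
    palindromeDigits t = reverse (upperHalf t) ++ (0 ∷ upperHalf t)

    palindrome : ℕ → ℕ
    palindrome t = fromDigits (palindromeDigits t)

    private
      upperHalf-< : ∀ t → All (_< b) (upperHalf t)
      upperHalf-< t = ++⁺ (paddedDigits-< L′ t) (s≤s (s≤s z≤n) ∷ [])

      length-upperHalf : ∀ t → length (upperHalf t) ≡ L
      length-upperHalf t = trans (length-++ (paddedDigits L′ t)) (trans (cong (_+ 1) (length-paddedDigits L′ t)) (+-comm L′ 1))

      length-palindromeDigits : ∀ t → length (palindromeDigits t) ≡ suc K
      length-palindromeDigits t = begin
        length (reverse (upperHalf t) ++ (0 ∷ upperHalf t))      ≡⟨ length-++ (reverse (upperHalf t)) ⟩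
        length (reverse (upperHalf t)) + suc (length (upperHalf t)) ≡⟨ cong₂ (λ m n → m + suc n) (trans (length-reverse (upperHalf t)) (length-upperHalf t)) (length-upperHalf t) ⟩
        L + suc L                                      ≡⟨ +-suc L L ⟩
        suc (L + L)                                    ≡⟨ cong (λ n → suc (L + n)) (+-identityʳ L) ⟨
        suc K                                          ∎
        where open ≡-Reasoning

      palindromeDigits-< : ∀ t → All (_< b) (palindromeDigits t)
      palindromeDigits-< t = ++⁺ (All-reverse (upperHalf-< t)) (s≤s z≤n ∷ upperHalf-< t)

      palindromeDigits-∷ʳ : ∀ t → palindromeDigits t ≡ (reverse (upperHalf t) ++ (0 ∷ paddedDigits L′ t)) ∷ʳ 1
      palindromeDigits-∷ʳ t = sym (++-assoc (reverse (upperHalf t)) (0 ∷ paddedDigits L′ t) [ 1 ])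

      digits-palindrome : ∀ t → digits b (palindrome t) ≡ palindromeDigits t
      digits-palindrome t = subst (λ es → digitsAux b (fromDigits es) (fromDigits es) ≡ es) (sym (palindromeDigits-∷ʳ t))
        (digitsAux-fromDigits _ (reverse (upperHalf t) ++ (0 ∷ paddedDigits L′ t))
          (++⁺ (All-reverse (upperHalf-< t)) (s≤s z≤n ∷ paddedDigits-< L′ t)) (s≤s z≤n) (s≤s (s≤s z≤n)) ≤-refl)

      low : ℕ → ℕ
      low t = fromDigits (reverse (upperHalf t))

      low< : ∀ t → low t < b ^ L
      low< t = subst (λ n → low t < b ^ n) (trans (length-reverse (upperHalf t)) (length-upperHalf t)) (fromDigits-< (All-reverse (upperHalf-< t)))

      high : ℕ → ℕ
      high t = (t + b ^ L′) * b * b ^ L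

      palindrome≡ : ∀ t → t < b ^ L′ → palindrome t ≡ low t + high t
      palindrome≡ t t<b^L′ = begin
        fromDigits (reverse (upperHalf t) ++ (0 ∷ upperHalf t))                          ≡⟨ fromDigits-++ (reverse (upperHalf t)) (0 ∷ upperHalf t) ⟩
        low t + (0 + fromDigits (upperHalf t) * b) * b ^ length (reverse (upperHalf t)) ≡⟨ cong₂ (λ v n → low t + (0 + v * b) * b ^ n) upperHalf-value (trans (length-reverse (upperHalf t)) (length-upperHalf t)) ⟩
        low t + (0 + (t + (1 + 0 * b) * b ^ L′) * b) * b ^ L                  ≡⟨ cong (low t +_) (normalise t b (b ^ L′) (b ^ L)) ⟩
        low t + high t                                                        ∎
        where
        open ≡-Reasoning
        upperHalf-value : fromDigits (upperHalf t) ≡ t + (1 + 0 * b) * b ^ L′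
        upperHalf-value = trans (fromDigits-++ (paddedDigits L′ t) [ 1 ])
          (cong₂ (λ v n → v + (1 + 0 * b) * b ^ n) (fromDigits-paddedDigits L′ t t<b^L′) (length-paddedDigits L′ t))
        normalise : ∀ t b p q → (0 + (t + (1 + 0 * b) * p) * b) * q ≡ (t + p) * b * q
        normalise = solve-∀

    palindrome-increasing : ∀ {s t} → s < t → t < b ^ L′ → palindrome s < palindrome t
    palindrome-increasing {s} {t} s<t t<b^L′ = begin-strict
      palindrome s                   ≡⟨ palindrome≡ s (<-trans s<t t<b^L′) ⟩
      low s + high s                 <⟨ +-monoˡ-< (high s) (low< s) ⟩
      b ^ L + high s                 ≤⟨ +-monoˡ-≤ (high s) (m≤n*m (b ^ L) b) ⟩
      b * b ^ L + high s             ≡⟨ step s b (b ^ L′) (b ^ L) ⟩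
      high (suc s)                   ≤⟨ *-monoˡ-≤ (b ^ L) (*-monoˡ-≤ b (+-monoˡ-≤ (b ^ L′) s<t)) ⟩
      high t                         ≤⟨ m≤n+m (high t) (low t) ⟩
      low t + high t                 ≡⟨ palindrome≡ t t<b^L′ ⟨
      palindrome t                   ∎
      where
      open ≤-Reasoning
      step : ∀ s b p q → b * q + (s + p) * b * q ≡ (suc s + p) * b * q
      step = solve-∀

    palindrome-∈Π : ∀ t → t < b ^ L′ → palindrome t ∈Π K
    palindrome-∈Π t t<b^L′ = lower , upper , isPalindrome
      where
      lower : b ^ K ≤ palindrome t
      lower = begin
        b ^ (2 * L)                       ≡⟨ b^[2L]≡b^L*b^L L ⟩
        b * b ^ L′ * b ^ L                ≡⟨ cong (_* b ^ L) (*-comm b (b ^ L′)) ⟩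
        b ^ L′ * b * b ^ L                ≤⟨ *-monoˡ-≤ (b ^ L) (*-monoˡ-≤ b (m≤n+m (b ^ L′) t)) ⟩
        high t                            ≤⟨ m≤n+m (high t) (low t) ⟩
        low t + high t                    ≡⟨ palindrome≡ t t<b^L′ ⟨
        palindrome t                      ∎
        where open ≤-Reasoning
      upper : palindrome t < b ^ suc K
      upper = subst (λ n → palindrome t < b ^ n) (length-palindromeDigits t) (fromDigits-< (palindromeDigits-< t))
      isPalindrome : IsPalindrome b (palindrome t)
      isPalindrome = subst (λ es → reverse es ≡ es) (sym (digits-palindrome t)) (reverse-mirror 0 (upperHalf t))

    b^L′≤#Π : b ^ L′ ≤ #[ ℓ < b ^ suc K ] isΠ K ℓ
    b^L′≤#Π = #<-increasing palindrome (b ^ L′) (b ^ suc K) palindrome-increasing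
      (λ t t<b^L′ → proj₁ (proj₂ (palindrome-∈Π t t<b^L′)) , ⇒does (palindrome t ∈Π? K) (palindrome-∈Π t t<b^L′))

  -- Bounds for S

  #Pal≡#Π : ∀ K → #Pal b K ≡ #[ ℓ < b ^ suc K ] isΠ K ℓ
  #Pal≡#Π K = begin
    length (filter (isPalindrome? b) (range lo hi))                 ≡⟨ length≡sum-map-1 (Pal b K) ⟩
    sum (map (λ _ → 1) (filter (isPalindrome? b) (range lo hi)))    ≡⟨ sum-map-filter (isPalindrome? b) (λ _ → 1) (range lo hi) ⟩
    sum (map (λ ℓ → 𝟙 (pal ℓ) * 1) (range lo hi))                  ≡⟨ sum-map-range (λ ℓ → 𝟙 (pal ℓ) * 1) lo hi (^-monoʳ-≤ b (n≤1+n K)) ⟩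
    ∑[ ℓ < hi ] (𝟙 (lo ≤ᵇ ℓ) * (𝟙 (pal ℓ) * 1))                    ≡⟨ ∑<-cong hi (λ ℓ ℓ<hi → inΠ ℓ (<⇒<ᵇ ℓ<hi)) ⟩
    #[ ℓ < hi ] isΠ K ℓ                                             ∎
    where
    open ≡-Reasoning
    lo hi : ℕ
    lo = b ^ K
    hi = b ^ suc K
    pal : ℕ → Bool
    pal ℓ = does (isPalindrome? b ℓ)
    inΠ : ∀ ℓ → T (ℓ <ᵇ hi) → 𝟙 (lo ≤ᵇ ℓ) * (𝟙 (pal ℓ) * 1) ≡ 𝟙 (isΠ K ℓ)
    inΠ ℓ ℓ<hi with lo ≤ᵇ ℓ | ℓ <ᵇ hi | pal ℓ
    ... | false | _    | _     = refl
    ... | true  | true | true  = refl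
    ... | true  | true | false = refl

  countDiv≤#Π-multiples : ∀ L n → countDiv b L n ≤ #Π-multiples (2 * L) (n * n)
  countDiv≤#Π-multiples L n = begin
    length (filter Q? (filter (isPalindrome? b) (range lo hi)))           ≡⟨ length≡sum-map-1 (filter Q? (Pal b K)) ⟩
    sum (map (λ _ → 1) (filter Q? (filter (isPalindrome? b) (range lo hi)))) ≡⟨ sum-map-filter Q? (λ _ → 1) (Pal b K) ⟩
    sum (map (λ ℓ → 𝟙 (does (Q? ℓ)) * 1) (filter (isPalindrome? b) (range lo hi))) ≡⟨ sum-map-filter (isPalindrome? b) (λ ℓ → 𝟙 (does (Q? ℓ)) * 1) (range lo hi) ⟩
    sum (map f (range lo hi))                                              ≡⟨ sum-map-range f lo hi (^-monoʳ-≤ b (n≤1+n K)) ⟩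
    ∑[ ℓ < hi ] (𝟙 (lo ≤ᵇ ℓ) * f ℓ)                                       ≤⟨ ∑<-mono hi (λ ℓ ℓ<hi → dropCoprimality ℓ (<⇒<ᵇ ℓ<hi)) ⟩
    #Π-multiples K (n * n)                                                 ∎
    where
    open ≤-Reasoning
    K lo hi : ℕ
    K = 2 * L
    lo = b ^ K
    hi = b ^ suc K
    Q? : ∀ ℓ → Dec (gcd ℓ b ≡ 1 × n * n ∣ ℓ)
    Q? ℓ = (gcd ℓ b ≟ 1) ×-dec ((n * n) ∣? ℓ)
    f : ℕ → ℕ
    f ℓ = 𝟙 (does (isPalindrome? b ℓ)) * (𝟙 (does (Q? ℓ)) * 1)
    dropCoprimality : ∀ ℓ → T (ℓ <ᵇ hi) → 𝟙 (lo ≤ᵇ ℓ) * f ℓ ≤ 𝟙 (isΠ K ℓ ∧ does ((n * n) ∣? ℓ))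
    dropCoprimality ℓ ℓ<hi with lo ≤ᵇ ℓ | ℓ <ᵇ hi | does (isPalindrome? b ℓ) | does (gcd ℓ b ≟ 1) | does ((n * n) ∣? ℓ)
    ... | false | _    | _     | _     | _     = z≤n
    ... | true  | true | false | _     | _     = z≤n
    ... | true  | true | true  | false | _     = z≤n
    ... | true  | true | true  | true  | false = z≤n
    ... | true  | true | true  | true  | true  = ≤-refl

  S≤∑#Π-multiples : ∀ L N → S b L N ≤ ∑[ n < suc N ] (𝟙 (does (N <? 2 * n)) * #Π-multiples (2 * L) (n * n))
  S≤∑#Π-multiples L N = begin
    sum (map (countDiv b L) (filter (λ n → N <? 2 * n) (range 1 (suc N))))    ≡⟨ sum-map-filter (λ n → N <? 2 * n) (countDiv b L) (range 1 (suc N)) ⟩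
    sum (map f (range 1 (suc N)))                                             ≡⟨ sum-map-range f 1 (suc N) (s≤s z≤n) ⟩
    ∑[ n < suc N ] (𝟙 (1 ≤ᵇ n) * f n)                                         ≤⟨ ∑<-mono (suc N) (λ n _ → bound n) ⟩
    ∑[ n < suc N ] (𝟙 (does (N <? 2 * n)) * #Π-multiples (2 * L) (n * n))    ∎
    where
    open ≤-Reasoning
    f : ℕ → ℕ
    f n = 𝟙 (does (N <? 2 * n)) * countDiv b L n
    bound : ∀ n → 𝟙 (1 ≤ᵇ n) * f n ≤ 𝟙 (does (N <? 2 * n)) * #Π-multiples (2 * L) (n * n)
    bound n = begin
      𝟙 (1 ≤ᵇ n) * f n   ≤⟨ *-monoˡ-≤ (f n) (𝟙≤1 (1 ≤ᵇ n)) ⟩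
      1 * f n            ≡⟨ *-identityˡ (f n) ⟩
      f n                ≤⟨ *-monoʳ-≤ (𝟙 (does (N <? 2 * n))) (countDiv≤#Π-multiples L n) ⟩
      𝟙 (does (N <? 2 * n)) * #Π-multiples (2 * L) (n * n) ∎

  c₁ c₂ : ℕ
  c₁ = 8 * (b * b + 1)
  c₂ = b * b * ((4 * b * (b + 2)) * (4 * b * (b + 2)))

  b^[1+K∸j]*b^j≡b^[1+K] : ∀ {K j} → j ≤ suc K → b ^ (suc K ∸ j) * b ^ j ≡ b ^ suc K
  b^[1+K∸j]*b^j≡b^[1+K] {K} {j} j≤1+K = trans (sym (^-distribˡ-+-* b (suc K ∸ j) j)) (cong (b ^_) (m∸n+n≡m j≤1+K))

  S*N²≤ : ∀ {L j} N → j ≤ suc (2 * L) →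
    S b L N * (N * N) ≤ suc N * (4 * (b ^ (suc (2 * L) ∸ j) + N * N * b ^ j))
  S*N²≤ {L} {j} N j≤1+K = begin
    S b L N * (N * N)                    ≤⟨ *-monoˡ-≤ (N * N) (S≤∑#Π-multiples L N) ⟩
    ∑[ n < suc N ] term n * (N * N)      ≡⟨ ∑<-*ʳ term (N * N) (suc N) ⟨
    ∑[ n < suc N ] (term n * (N * N))    ≤⟨ ∑<-≤-* (suc N) (λ n n≤N → termBound n (m<1+n⇒m≤n n≤N) (T? (does (N <? 2 * n)))) ⟩
    suc N * (4 * (B + N * N * b ^ j))    ∎
    where
    open ≤-Reasoning
    K B : ℕ
    K = 2 * L
    B = b ^ (suc K ∸ j)
    term : ℕ → ℕ
    term n = 𝟙 (does (N <? 2 * n)) * #Π-multiples K (n * n)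
    termBound : ∀ n → n ≤ N → Dec (T (does (N <? 2 * n))) → term n * (N * N) ≤ 4 * (B + N * N * b ^ j)
    termBound n _ (no N≮2n) = subst (λ k → k * #Π-multiples K (n * n) * (N * N) ≤ _) (sym (𝟙-false N≮2n)) z≤n
    termBound (suc n-1) n≤N (yes N<2n) = begin
      𝟙 (does (N <? 2 * n)) * # * (N * N)  ≡⟨ cong (λ k → k * # * (N * N)) (𝟙-true N<2n) ⟩
      1 * # * (N * N)                       ≡⟨ cong (_* (N * N)) (*-identityˡ #) ⟩
      # * (N * N)                           ≤⟨ *-monoʳ-≤ # (m<2n⇒m*m≤4*[n*n] {n = n} (<ᵇ⇒< N (2 * n) N<2n)) ⟩
      # * (4 * (n * n))                     ≡⟨ reorder # (n * n) ⟩
      4 * (# * (n * n))                     ≤⟨ *-monoʳ-≤ 4 (#Π-multiples*q≤ j≤1+K (n * n)) ⟩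
      4 * (B + n * n * b ^ j)               ≤⟨ *-monoʳ-≤ 4 (+-monoʳ-≤ B (*-monoˡ-≤ (b ^ j) (*-mono-≤ n≤N n≤N))) ⟩
      4 * (B + N * N * b ^ j)               ∎
      where
      n # : ℕ
      n = suc n-1
      # = #Π-multiples K (n * n)
      reorder : ∀ a q → a * (4 * q) ≡ 4 * (a * q)
      reorder = solve-∀

  -- j is chosen with b^j ≈ b^L / N, which balances the two terms of S*N²≤.
  N≤b^L⇒S≤c₁*b^L : ∀ L N .{{_ : NonZero N}} → N ≤ b ^ L → S b L N ≤ c₁ * b ^ L
  N≤b^L⇒S≤c₁*b^L L N N≤M with pow-bracket-/ b (s≤s (s≤s z≤n)) N≤M
  ... | j , b^j*N≤M , M<b^[1+j]*N = *-cancelʳ-≤ (S b L N) (c₁ * M) (N * N) {{m*n≢0 N N}} (begin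
    S b L N * (N * N)                          ≤⟨ S*N²≤ {L} N j≤1+K ⟩
    suc N * (4 * (B + N * N * b ^ j))          ≤⟨ *-mono-≤ (+-monoˡ-≤ N (>-nonZero⁻¹ N)) (*-monoʳ-≤ 4 (+-mono-≤ B≤ N*N*b^j≤)) ⟩
    (N + N) * (4 * (b * b * N * M + N * M))    ≡⟨ normalise N b M ⟩
    8 * (b * b + 1) * M * (N * N)              ∎)
    where
    open ≤-Reasoning
    M K B : ℕ
    M = b ^ L
    K = 2 * L
    B = b ^ (suc K ∸ j)
    normalise : ∀ n b m → (n + n) * (4 * (b * b * n * m + n * m)) ≡ 8 * (b * b + 1) * m * (n * n)
    normalise = solve-∀
    j≤1+K : j ≤ suc K
    j≤1+K = ≤-trans j≤L (≤-trans (m≤m+n L (L + 0)) (n≤1+n K))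
      where
      j≤L : j ≤ L
      j≤L = ≮⇒≥ λ L<j → <⇒≱ (^-monoʳ-< b (s≤s (s≤s z≤n)) L<j) (≤-trans (m≤m*n (b ^ j) N) b^j*N≤M)
    B≤ : B ≤ b * b * N * M
    B≤ = *-cancelʳ-≤ B (b * b * N * M) (b ^ j) {{m^n≢0 b j}} (begin
      B * b ^ j                  ≡⟨ b^[1+K∸j]*b^j≡b^[1+K] j≤1+K ⟩
      b * b ^ (2 * L)            ≡⟨ cong (b *_) (b^[2L]≡b^L*b^L L) ⟩
      b * (M * M)                ≤⟨ *-monoʳ-≤ b (*-monoʳ-≤ M (<⇒≤ M<b^[1+j]*N)) ⟩
      b * (M * (b * b ^ j * N))  ≡⟨ rearrange b M (b ^ j) N ⟩
      b * b * N * M * b ^ j      ∎)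
      where
      rearrange : ∀ b m p n → b * (m * (b * p * n)) ≡ b * b * n * m * p
      rearrange = solve-∀
    N*N*b^j≤ : N * N * b ^ j ≤ N * M
    N*N*b^j≤ = begin
      N * N * b ^ j    ≡⟨ rearrange N (b ^ j) ⟩
      N * (b ^ j * N)  ≤⟨ *-monoʳ-≤ N b^j*N≤M ⟩
      N * M            ∎
      where
      rearrange : ∀ n p → n * n * p ≡ n * (p * n)
      rearrange = solve-∀

  #Π-multiples≤#cofactors : ∀ K q .{{_ : NonZero q}} → #Π-multiples K q ≤ #[ d < b ^ suc K ] isΠ K (d * q)
  #Π-multiples≤#cofactors K q = begin
    #[ ℓ < hi ] g ℓ            ≤⟨ ∑<-monoʳ (λ ℓ → 𝟙 (g ℓ)) (m≤m*n hi q) ⟩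
    #[ ℓ < hi * q ] g ℓ        ≡⟨ #<-multiples g q (λ ℓ gℓ → does⇒ (q ∣? ℓ) (proj₂ (Equivalence.to (T-∧ {isΠ K ℓ}) gℓ))) hi ⟩
    #[ d < hi ] g (d * q)      ≤⟨ #<-mono hi (λ d _ → proj₁ ∘ Equivalence.to (T-∧ {isΠ K (d * q)})) ⟩
    #[ d < hi ] isΠ K (d * q)  ∎
    where
    open ≤-Reasoning
    hi : ℕ
    hi = b ^ suc K
    g : ℕ → Bool
    g ℓ = isΠ K ℓ ∧ does (q ∣? ℓ)

  S≤∑#Π-d*n² : ∀ L N → S b L N ≤ ∑[ d < b ^ suc (2 * L) ] #Π-d*n² (2 * L) N d
  S≤∑#Π-d*n² L N = begin
    S b L N                                                          ≤⟨ S≤∑#Π-multiples L N ⟩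
    ∑[ n < suc N ] (𝟙 (does (N <? 2 * n)) * #Π-multiples K (n * n))  ≤⟨ ∑<-mono (suc N) (λ n _ → cofactors n) ⟩
    ∑[ n < suc N ] #[ d < hi ] h n d                                 ≡⟨ ∑<-comm (λ n d → 𝟙 (h n d)) (suc N) hi ⟩
    ∑[ d < hi ] #[ n < suc N ] h n d                                 ∎
    where
    open ≤-Reasoning
    K hi : ℕ
    K = 2 * L
    hi = b ^ suc K
    h : ℕ → ℕ → Bool
    h n d = does (N <? 2 * n) ∧ isΠ K (d * (n * n))
    cofactors : ∀ n → 𝟙 (does (N <? 2 * n)) * #Π-multiples K (n * n) ≤ #[ d < hi ] h n d
    cofactors zero    = z≤n
    cofactors (suc n) with does (N <? 2 * suc n)
    ... | false = z≤n
    ... | true  = ≤-trans (≤-reflexive (+-identityʳ _)) (#Π-multiples≤#cofactors K (suc n * suc n))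

  [b^[1+K∸j]/[N*d]]*b^j≤b*N : ∀ {K j} N d .{{_ : NonZero N}} .{{_ : NonZero d}} → j ≤ suc K → b ^ K ≤ d * (N * N) →
    _/_ (b ^ (suc K ∸ j)) (N * d) {{m*n≢0 N d}} * b ^ j ≤ b * N
  [b^[1+K∸j]/[N*d]]*b^j≤b*N {K} {j} N d j≤1+K b^K≤dN² = *-cancelʳ-≤ (W * b ^ j) (b * N) (d * (N * N)) {{m*n≢0 d (N * N)}} (begin
    W * b ^ j * (d * (N * N))    ≡⟨ regroup W (b ^ j) d N ⟩
    W * (N * d) * (b ^ j * N)    ≤⟨ *-monoˡ-≤ (b ^ j * N) (m/n*n≤m B (N * d)) ⟩
    B * (b ^ j * N)              ≡⟨ *-assoc B (b ^ j) N ⟨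
    B * b ^ j * N                ≡⟨ cong (_* N) (b^[1+K∸j]*b^j≡b^[1+K] j≤1+K) ⟩
    b * b ^ K * N                ≤⟨ *-monoˡ-≤ N (*-monoʳ-≤ b b^K≤dN²) ⟩
    b * (d * (N * N)) * N        ≡⟨ regroup′ b d N ⟩
    b * N * (d * (N * N))        ∎)
    where
    open ≤-Reasoning
    instance
      N*d≢0 : NonZero (N * d)
      N*d≢0 = m*n≢0 N d
      N*N≢0 : NonZero (N * N)
      N*N≢0 = m*n≢0 N N
    B W : ℕ
    B = b ^ (suc K ∸ j)
    W = B / (N * d)
    regroup : ∀ w p d n → w * p * (d * (n * n)) ≡ w * (n * d) * (p * n)
    regroup = solve-∀
    regroup′ : ∀ b d n → b * (d * (n * n)) * n ≡ b * n * (d * (n * n))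
    regroup′ = solve-∀

  #Π-d*n²*b^j≤ : ∀ {K j} N d .{{_ : NonZero N}} → j ≤ suc K →
    #Π-d*n² K N d * b ^ j ≤ 𝟙 ((b ^ K ≤ᵇ d * (N * N)) ∧ (d * (N * N) <ᵇ 4 * b ^ suc K)) * (b * N + (1 + b ^ j) * b ^ j)
  #Π-d*n²*b^j≤ {K} {j} N d j≤1+K = cases (T? (b ^ K ≤ᵇ d * (N * N))) (T? (d * (N * N) <ᵇ 4 * hi))
    where
    open ≤-Reasoning
    hi V : ℕ
    hi = b ^ suc K
    V = b * N + (1 + b ^ j) * b ^ j
    parts : ∀ {n} → T (does (N <? 2 * n) ∧ isΠ K (d * (n * n))) → N < 2 * n × d * (n * n) ∈Π K
    parts {n} gn with Equivalence.to (T-∧ {does (N <? 2 * n)}) gn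
    ... | N<2n , inΠ = <ᵇ⇒< N (2 * n) N<2n , isΠ⇒∈Π K inΠ
    none : ∀ {z} → (∀ {n} → n ≤ N → N < 2 * n → d * (n * n) ∈Π K → ⊥) → #Π-d*n² K N d * b ^ j ≤ z
    none {z} impossible = subst (λ k → k * b ^ j ≤ z) (sym (#<-none (suc N) λ n n≤N gn →
      impossible {n} (m<1+n⇒m≤n n≤N) (proj₁ (parts {n} gn)) (proj₂ (parts {n} gn)))) z≤n
    cases : Dec (T (b ^ K ≤ᵇ d * (N * N))) → Dec (T (d * (N * N) <ᵇ 4 * hi)) →
      #Π-d*n² K N d * b ^ j ≤ 𝟙 ((b ^ K ≤ᵇ d * (N * N)) ∧ (d * (N * N) <ᵇ 4 * hi)) * V
    cases (no small) _ = none λ n≤N _ (b^K≤dn² , _ , _) → small (≤⇒≤ᵇ (≤-trans b^K≤dn² (*-monoʳ-≤ d (*-mono-≤ n≤N n≤N))))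
    cases (yes _) (no large) = none λ {n} _ N<2n (_ , dn²<hi , _) → large (<⇒<ᵇ (begin-strict
      d * (N * N)          ≤⟨ *-monoʳ-≤ d (m<2n⇒m*m≤4*[n*n] {n = n} N<2n) ⟩
      d * (4 * (n * n))    ≡⟨ swap d (n * n) ⟩
      4 * (d * (n * n))    <⟨ *-monoʳ-< 4 dn²<hi ⟩
      4 * hi               ∎))
      where
      swap : ∀ d q → d * (4 * q) ≡ 4 * (d * q)
      swap = solve-∀
    cases (yes b^K≤dN²) (yes dN²<4hi) = begin
      #Π-d*n² K N d * b ^ j           ≤⟨ *-monoˡ-≤ (b ^ j) (#Π-d*n²≤ j≤1+K N d {{m*n≢0 N d}}) ⟩
      (1 + W + b ^ j) * b ^ j         ≡⟨ rearrange W (b ^ j) ⟩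
      W * b ^ j + (1 + b ^ j) * b ^ j ≤⟨ +-monoˡ-≤ _ ([b^[1+K∸j]/[N*d]]*b^j≤b*N N d j≤1+K (≤ᵇ⇒≤ _ _ b^K≤dN²)) ⟩
      V                               ≡⟨ +-identityʳ V ⟨
      1 * V                           ≡⟨ cong (_* V) (𝟙-true (Equivalence.from T-∧ (b^K≤dN² , dN²<4hi))) ⟨
      𝟙 ((b ^ K ≤ᵇ d * (N * N)) ∧ (d * (N * N) <ᵇ 4 * hi)) * V ∎
      where
      instance
        d≢0 : NonZero d
        d≢0 = m*n≢0⇒m≢0 d {{>-nonZero (≤-trans (m^n>0 b K) (≤ᵇ⇒≤ _ _ b^K≤dN²))}}
      W : ℕ
      W = _/_ (b ^ (suc K ∸ j)) (N * d) {{m*n≢0 N d}}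
      rearrange : ∀ w p → (1 + w + p) * p ≡ w * p + (1 + p) * p
      rearrange = solve-∀

  S*b^j*N²≤ : ∀ {L j} N .{{_ : NonZero N}} → j ≤ suc (2 * L) →
    S b L N * b ^ j * (N * N) ≤ 4 * b ^ suc (2 * L) * (b * N + (1 + b ^ j) * b ^ j)
  S*b^j*N²≤ {L} {j} N j≤1+K = begin
    S b L N * b ^ j * (N * N)                          ≤⟨ *-monoˡ-≤ (N * N) (*-monoˡ-≤ (b ^ j) (S≤∑#Π-d*n² L N)) ⟩
    ∑[ d < hi ] #Π-d*n² K N d * b ^ j * (N * N)        ≡⟨ cong (_* (N * N)) (∑<-*ʳ (#Π-d*n² K N) (b ^ j) hi) ⟨
    ∑[ d < hi ] (#Π-d*n² K N d * b ^ j) * (N * N)      ≤⟨ *-monoˡ-≤ (N * N) (∑<-mono hi (λ d _ → #Π-d*n²*b^j≤ N d j≤1+K)) ⟩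
    ∑[ d < hi ] (𝟙 (relevant d) * V) * (N * N)         ≡⟨ cong (_* (N * N)) (∑<-*ʳ (λ d → 𝟙 (relevant d)) V hi) ⟩
    #< hi relevant * V * (N * N)                       ≡⟨ swap (#< hi relevant) V (N * N) ⟩
    #< hi relevant * (N * N) * V                       ≤⟨ *-monoˡ-≤ V (*-monoˡ-≤ (N * N) relevant≤positive) ⟩
    #[ d < hi ] ((1 ≤ᵇ d) ∧ (d * (N * N) <ᵇ 4 * hi)) * (N * N) * V ≤⟨ *-monoˡ-≤ V (#<-positive-multiples (N * N) (4 * hi) hi) ⟩
    4 * hi * V                                         ∎
    where
    open ≤-Reasoning
    K hi V : ℕ
    K = 2 * L
    hi = b ^ suc K
    V = b * N + (1 + b ^ j) * b ^ j
    relevant : ℕ → Bool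
    relevant d = (b ^ K ≤ᵇ d * (N * N)) ∧ (d * (N * N) <ᵇ 4 * hi)
    relevant≤positive : #< hi relevant ≤ #[ d < hi ] ((1 ≤ᵇ d) ∧ (d * (N * N) <ᵇ 4 * hi))
    relevant≤positive = #<-mono hi λ where
      zero    _ rel → <⇒≱ (m^n>0 b K) (≤ᵇ⇒≤ _ _ (proj₁ (Equivalence.to (T-∧ {b ^ K ≤ᵇ 0}) rel)))
      (suc d) _ rel → proj₂ (Equivalence.to (T-∧ {b ^ K ≤ᵇ suc d * (N * N)}) rel)
    swap : ∀ a v q → a * v * q ≡ a * q * v
    swap = solve-∀

  hi≤q⇒#Π-multiples≡0 : ∀ K q → b ^ suc K ≤ q → #Π-multiples K q ≡ 0
  hi≤q⇒#Π-multiples≡0 K q hi≤q = #<-none (b ^ suc K) λ ℓ ℓ<hi gℓ →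
    let (b^K≤ℓ , _ , _) = isΠ⇒∈Π K (proj₁ (Equivalence.to (T-∧ {isΠ K ℓ}) gℓ))
        q∣ℓ = does⇒ (q ∣? ℓ) (proj₂ (Equivalence.to (T-∧ {isΠ K ℓ}) gℓ))
    in <⇒≱ (<-≤-trans ℓ<hi hi≤q) (∣⇒≤ {{>-nonZero (≤-trans (m^n>0 b K) b^K≤ℓ)}} q∣ℓ)

  4*b^[1+2L]<N²⇒S≡0 : ∀ L N → 4 * b ^ suc (2 * L) < N * N → S b L N ≡ 0
  4*b^[1+2L]<N²⇒S≡0 L N 4hi<N² = n≤0⇒n≡0 (≤-trans (S≤∑#Π-multiples L N) (≤-reflexive (∑<-zero (suc N) λ n _ → noTerm n (T? (does (N <? 2 * n))))))
    where
    noTerm : ∀ n → Dec (T (does (N <? 2 * n))) → 𝟙 (does (N <? 2 * n)) * #Π-multiples (2 * L) (n * n) ≡ 0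
    noTerm n (no N≮2n) = cong (_* #Π-multiples (2 * L) (n * n)) (𝟙-false N≮2n)
    noTerm n (yes N<2n) = trans (cong (𝟙 (does (N <? 2 * n)) *_) (hi≤q⇒#Π-multiples≡0 (2 * L) (n * n) hi≤n*n)) (*-zeroʳ (𝟙 (does (N <? 2 * n))))
      where
      hi≤n*n : b ^ suc (2 * L) ≤ n * n
      hi≤n*n = *-cancelˡ-≤ 4 (<⇒≤ (<-≤-trans 4hi<N² (m<2n⇒m*m≤4*[n*n] {n = n} (<ᵇ⇒< N (2 * n) N<2n))))

  [b*b]^j≤N⇒j≤1+K : ∀ {K j N} → N * N ≤ 4 * b ^ suc K → (b * b) ^ j ≤ N → j ≤ suc K
  [b*b]^j≤N⇒j≤1+K {K} {j} {N} N²≤4hi [b*b]^j≤N = ≮⇒≥ λ 1+K<j → <⇒≱ (N<N*N (4hi≤N 1+K<j)) (≤-trans N²≤4hi (4hi≤N 1+K<j))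
    where
    open ≤-Reasoning
    4≤b*b : 4 ≤ b * b
    4≤b*b = *-mono-≤ {2} {b} {2} {b} (s≤s (s≤s z≤n)) (s≤s (s≤s z≤n))
    4hi≤N : suc K < j → 4 * b ^ suc K ≤ N
    4hi≤N 1+K<j = begin
      4 * b ^ suc K              ≤⟨ *-mono-≤ 4≤b*b (^-monoˡ-≤ (suc K) (m≤m*n b b)) ⟩
      b * b * (b * b) ^ suc K    ≤⟨ ^-monoʳ-≤ (b * b) 1+K<j ⟩
      (b * b) ^ j                ≤⟨ [b*b]^j≤N ⟩
      N                          ∎
    N<N*N : 4 * b ^ suc K ≤ N → N < N * N
    N<N*N 4hi≤N = m<m*n N N {{>-nonZero (≤-trans (s≤s z≤n) 4≤N)}} (≤-trans (s≤s (s≤s z≤n)) 4≤N)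
      where
      4≤N : 4 ≤ N
      4≤N = ≤-trans (m≤m*n 4 (b ^ suc K) {{m^n≢0 b (suc K)}}) 4hi≤N

  S*b^j*N≤ : ∀ {L j} N .{{_ : NonZero N}} → j ≤ suc (2 * L) → b ^ j * b ^ j ≤ N →
    S b L N * b ^ j * N ≤ 4 * b * (b + 2) * (b ^ L * b ^ L)
  S*b^j*N≤ {L} {j} N j≤1+K b^j*b^j≤N = *-cancelʳ-≤ _ _ N (begin
    S b L N * b ^ j * N * N                        ≡⟨ *-assoc (S b L N * b ^ j) N N ⟩
    S b L N * b ^ j * (N * N)                      ≤⟨ S*b^j*N²≤ {L} N j≤1+K ⟩
    4 * b ^ suc (2 * L) * (b * N + (1 + b ^ j) * b ^ j) ≤⟨ *-monoʳ-≤ (4 * b ^ suc (2 * L)) (+-monoʳ-≤ (b * N) [1+b^j]*b^j≤2N) ⟩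
    4 * b ^ suc (2 * L) * (b * N + 2 * N)          ≡⟨ cong (λ h → 4 * (b * h) * (b * N + 2 * N)) (b^[2L]≡b^L*b^L L) ⟩
    4 * (b * (M * M)) * (b * N + 2 * N)            ≡⟨ normalise b M N ⟩
    4 * b * (b + 2) * (M * M) * N                  ∎)
    where
    open ≤-Reasoning
    M : ℕ
    M = b ^ L
    normalise : ∀ b m n → 4 * (b * (m * m)) * (b * n + 2 * n) ≡ 4 * b * (b + 2) * (m * m) * n
    normalise = solve-∀
    [1+b^j]*b^j≤2N : (1 + b ^ j) * b ^ j ≤ 2 * N
    [1+b^j]*b^j≤2N = begin
      b ^ j + b ^ j * b ^ j           ≤⟨ +-monoˡ-≤ (b ^ j * b ^ j) (m≤m*n (b ^ j) (b ^ j) {{m^n≢0 b j}}) ⟩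
      b ^ j * b ^ j + b ^ j * b ^ j   ≤⟨ +-mono-≤ b^j*b^j≤N b^j*b^j≤N ⟩
      N + N                           ≡⟨ cong (N +_) (+-identityʳ N) ⟨
      2 * N                           ∎

  -- j is chosen with b^(2j) ≈ N.
  S²*N³≤ : ∀ L N .{{_ : NonZero N}} → S b L N * S b L N * (N * N * N) ≤ c₂ * (b ^ L * b ^ L * b ^ L * b ^ L)
  S²*N³≤ L N with 4 * b ^ suc (2 * L) <? N * N
  ... | yes 4hi<N² rewrite 4*b^[1+2L]<N²⇒S≡0 L N 4hi<N² = z≤n
  ... | no  4hi≮N² with pow-bracket (b * b) (s≤s (s≤s z≤n)) N (>-nonZero⁻¹ N)
  ...   | j , [b*b]^j≤N , N<[b*b]^[1+j] = begin
    s * s * (N * N * N)                           ≤⟨ *-monoʳ-≤ (s * s) (*-monoʳ-≤ (N * N) N≤b*b*b^j*b^j) ⟩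
    s * s * (N * N * (b * b * (b ^ j * b ^ j)))   ≡⟨ regroup s N b (b ^ j) ⟩
    b * b * (X * X)                               ≤⟨ *-monoʳ-≤ (b * b) (*-mono-≤ X≤ X≤) ⟩
    b * b * (D * (M * M) * (D * (M * M)))         ≡⟨ regroup′ b D M ⟩
    b * b * (D * D) * (M * M * M * M)             ∎
    where
    open ≤-Reasoning
    s M D X : ℕ
    s = S b L N
    M = b ^ L
    D = 4 * b * (b + 2)
    X = s * b ^ j * N
    regroup : ∀ s n b p → s * s * (n * n * (b * b * (p * p))) ≡ b * b * ((s * p * n) * (s * p * n))
    regroup = solve-∀
    regroup′ : ∀ b d m → b * b * (d * (m * m) * (d * (m * m))) ≡ b * b * (d * d) * (m * m * m * m)
    regroup′ = solve-∀
    N≤b*b*b^j*b^j : N ≤ b * b * (b ^ j * b ^ j)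
    N≤b*b*b^j*b^j = <⇒≤ (subst (N <_) (cong (b * b *_) (^-distribʳ-* b b j)) N<[b*b]^[1+j])
    X≤ : X ≤ D * (M * M)
    X≤ = S*b^j*N≤ {L} N ([b*b]^j≤N⇒j≤1+K {j = j} (≮⇒≥ 4hi≮N²) [b*b]^j≤N) (subst (_≤ N) (^-distribʳ-* b b j) [b*b]^j≤N)

  S^10*N^8≤ : ∀ L N .{{_ : NonZero N}} → S b L N ^ 10 * N ^ 8 ≤ (c₁ ^ 10 + c₂ ^ 5) * (b ^ L) ^ 16
  S^10*N^8≤ L N = interpolate (S b L N) N (b ^ L) c₁ c₂ {{m^n≢0 b L}} (N≤b^L⇒S≤c₁*b^L L N) (S²*N³≤ L N)

  b^L≤b*#Pal : ∀ L′ → b ^ suc L′ ≤ b * #Pal b (2 * suc L′)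
  b^L≤b*#Pal L′ = *-monoʳ-≤ b (subst (b ^ L′ ≤_) (sym (#Pal≡#Π (2 * suc L′))) (b^L′≤#Π L′))

  S^[10m]*N^[8m]≤ : ∀ m L N .{{_ : NonZero N}} → 1 ≤ L →
    S b L N ^ (10 * m) * N ^ (8 * m) ≤ (c₁ ^ 10 + c₂ ^ 5) ^ m * b ^ (10 * m) * (b ^ (2 * L)) ^ (3 * m + 10) * #Pal b (2 * L) ^ (10 * m)
  S^[10m]*N^[8m]≤ m L@(suc L′) N _ =
    power-bound m (b ^ (2 * L)) (#Pal b (2 * L)) b {{m^n≢0 b (2 * L)}} (S^10*N^8≤ L N) (sym (b^[2L]≡b^L*b^L L)) (b^L≤b*#Pal L′)

propositionA1 : (b : ℕ) → 1 < b → (m : ℕ) → 1 ≤ m →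
    ∃ λ (C : ℕ) → (L N : ℕ) → 1 ≤ L → 1 ≤ N →
      S b L N ^ (10 * m) * N ^ (8 * m)
        ≤ C * (b ^ (2 * L)) ^ (3 * m + 10) * #Pal b (2 * L) ^ (10 * m)
propositionA1 (suc (suc c)) _ m _ =
  (c₁ ^ 10 + c₂ ^ 5) ^ m * b ^ (10 * m) , λ L N 1≤L 1≤N → S^[10m]*N^[8m]≤ m L N {{>-nonZero 1≤N}} 1≤L
  where
  open Base c
propositionA1 1 1<1 _ _ = contradiction 1<1 (<-irrefl refl)
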